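{- Let $(k_n)_{n\ge1}$ be scalars and let $\kappa\in\mathfrak g_H$ be the infinitesimal character with $\kappa(I_n)=k_n$ for $n\ge1$ and $\kappa(P)=0$ for every other $P\in\mathrm{NCP}$. Then for every $P\in\mathrm{NCP}$, $\mathcal E_\prec(\kappa)(P)=\prod_{\pi\in P}k_{\sharp\pi}$, and for every $n\ge1$, $$(\mathcal E_\prec(\kappa)\curvearrowleft\zeta)(J_n)=\sum_{Q\in\mathrm{NCP}(n)}\prod_{\pi\in Q}k_{\sharp\pi}.$$
   Context: $\mathbb K$ is a field of characteristic $0$. Noncrossing partitions (no $a,b$ in one block, $c,d$ in another with $a<c<b<d$) are identified with standard representatives on $[n]$; restrictions $P_{|X}$ are standardized; $\mathrm{NCP}(n)$: noncrossing partitions of $[n]$, $\mathrm{NCP}=\bigcup_{n\ge1}\mathrm{NCP}(n)$; $I_n=\{[n]\}$ and $J_n=\{\{1\},\dots,\{n\}\}$; $P\le Q$ means each block of $Q$ is a union of blocks of $P$. Cuts: for blocks write $\pi\to\rho$ if $[\min\pi,\max\pi]\cap\rho\neq\emptyset$; uppersets/lowersets are sets of blocks closed upward/downward; a cut $(L,U)$ is a lowerset with its complement. If $x_1<\dots<x_k$ are the elements of $\bigcup L$, let $D_0=\{y<x_1\},D_i=\{x_i<y<x_{i+1}\},D_k=\{y>x_k\}$ ($D_0=[n]$ if $k=0$), $U_i=P_{|D_i}$; the reduced gap monomial is the word of the nonempty $U_i$. $H$: free associative unital algebra on $\mathrm{NCP}$, basis words $P_1\cdots P_r$, $H_+$ spanned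 by nonempty words, counit $\varepsilon_H$. A cut of $P_1\cdots P_r$ is a tuple of cuts of the $P_i$ with term $L_1\cdots L_r\otimes M_1\cdots M_r$ ($L_i$ the partition of blocks of the lowerset, omitted if empty; $M_i$ the reduced gap monomial). $\Delta_\prec(P)$: sum of terms over cuts where the block containing the element $1$ of $P_1$ lies in $L_1$. For $f,g\in H^*$: $(f\prec g)(\mathbf1)=0$ and $(f\prec g)(x)=(f\otimes g)\Delta_\prec(x)$ for $x\in H_+$. $\mathfrak g_H$: infinitesimal characters of $H$ (linear, vanishing on $\mathbf1$ and on products of two elements of $H_+$). For $\kappa\in\mathfrak g_H$, $\mathcal E_\prec(\kappa)$ is the unique linear form $\phi$ on $H$ with $\phi=\varepsilon_H+\kappa\prec\phi$ (a character of $H$). $A$: free commutative unital algebra on $\mathrm{NCP}$; $P/Q=\prod_{\tau\in Q}P_{|\tau}\in A$; $\zeta$ is the character of $A$ with $\zeta(P)=1$ for all $P\in\mathrm{NCP}$. $\rho\colon H\to H\otimes A$ is the algebra morphism $\rho(P)=\sum_{Q\in\mathrm{NCP}(n),\,Q\ge P}Q\otimes P/Q$, and for $\alpha\in H^*$ and a character $\phi$ of $A$, $\alpha\curvearrowleft\phi:=(\alpha\otimes\phi)\circ\rho$. -}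

module Defs where

open import Level using (_⊔_)
open import Data.Bool using (Bool; true; false; _∧_; _∨_; not; if_then_else_; T)
open import Data.Nat as ℕ using (ℕ; zero; suc; _≡ᵇ_; _<ᵇ_; _≤ᵇ_)
open import Data.Maybe using (Maybe; just; nothing)
open import Data.List using (List; []; _∷_; [_]; map; filter; length; concat; concatMap;
                             upTo; foldr; replicate; _++_; zipWith)
open import Data.Product using (_×_; _,_; Σ; ∃)
open import Relation.Nullary using (¬_)
open import Relation.Binary.PropositionalEquality using (_≡_; _≢_)
open import Algebra.Bundles using (CommutativeRing)

module _ {c ℓ} (R : CommutativeRing c ℓ) where
  open CommutativeRing R

  natScalar : ℕ → Carrier
  natScalar zero    = 0#
  natScalar (suc n) = 1# + natScalar n

  record IsFieldChar0 : Set (c ⊔ ℓ) where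
    field
      nontrivial : ¬ (1# ≈ 0#)
      inverses   : ∀ x → ¬ (x ≈ 0#) → ∃ λ y → x * y ≈ 1#
      char0      : ∀ n → ¬ (natScalar (suc n) ≈ 0#)

-- A partition of [n] = {1,..,n} is encoded by its standard representative as
-- a restricted growth string: a list of length n whose (i+1)-th entry is the
-- label of the block containing the element i+1 (positions are 0-based here),
-- blocks being labelled 0,1,2,... in order of their minimal elements.

all : {A : Set} → (A → Bool) → List A → Bool
all p = foldr (λ x r → p x ∧ r) true

any : {A : Set} → (A → Bool) → List A → Bool
any p = foldr (λ x r → p x ∨ r) false

elemᵇ : ℕ → List ℕ → Bool
elemᵇ x = any (λ y → x ≡ᵇ y)

-- entry at a position (default 0 outside the list; only used inside)
at : List ℕ → ℕ → ℕ
at []       _       = 0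
at (x ∷ xs) zero    = x
at (x ∷ xs) (suc i) = at xs i

atB : List Bool → ℕ → Bool
atB []       _       = false
atB (x ∷ xs) zero    = x
atB (x ∷ xs) (suc i) = atB xs i

rgsFrom : ℕ → List ℕ → Bool
rgsFrom m []       = true
rgsFrom m (x ∷ xs) = (x ≤ᵇ m) ∧ rgsFrom (if x ≡ᵇ m then suc m else m) xs

isRGS : List ℕ → Bool
isRGS = rgsFrom 0

nBlocks : List ℕ → ℕ
nBlocks = foldr (λ x r → suc x ℕ.⊔ r) 0

blockOf : List ℕ → ℕ → List ℕ
blockOf P j = filter (λ i → at P i ℕ.≟ j) (upTo (length P))

nonCrossing : List ℕ → Bool
nonCrossing P =
  all (λ a → all (λ c → all (λ b → all (λ d →
     not ((a <ᵇ c) ∧ (c <ᵇ b) ∧ (b <ᵇ d) ∧ (at P a ≡ᵇ at P b) ∧ (at P c ≡ᵇ at P d)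
          ∧ not (at P a ≡ᵇ at P c)))
     ns) ns) ns) ns
  where ns = upTo (length P)

nonEmpty : List ℕ → Bool
nonEmpty []      = false
nonEmpty (_ ∷ _) = true

isNCP : List ℕ → Bool
isNCP P = nonEmpty P ∧ isRGS P ∧ nonCrossing P

IsNCP : List ℕ → Set
IsNCP P = T (isNCP P)

allLists : ℕ → ℕ → List (List ℕ)
allLists m zero    = [] ∷ []
allLists m (suc n) = concatMap (λ x → map (x ∷_) (allLists m n)) (upTo m)

NCPs : ℕ → List (List ℕ)
NCPs n = filter (λ P → T? (isNCP P)) (allLists n n)
  where
  open import Relation.Nullary.Decidable using (Dec)
  open import Data.Bool.Properties using (T?)

I : ℕ → List ℕ
I n = replicate n 0

J : ℕ → List ℕ
J n = upTo n

indexOf : ℕ → List ℕ → Maybe ℕ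
indexOf x []       = nothing
indexOf x (y ∷ ys) = if x ≡ᵇ y then just 0 else Data.Maybe.map suc (indexOf x ys)
  where import Data.Maybe

standardizeWith : List ℕ → List ℕ → List ℕ
standardizeWith seen []       = []
standardizeWith seen (x ∷ xs) with indexOf x seen
... | just i  = i ∷ standardizeWith seen xs
... | nothing = length seen ∷ standardizeWith (seen ++ [ x ]) xs

-- restriction P_{|X} (X a list of positions in increasing order), standardized
restrict : List ℕ → List ℕ → List ℕ
restrict P X = standardizeWith [] (map (at P) X)

arrow : List ℕ → ℕ → ℕ → Bool
arrow P π ρ = any (λ i → (at P i ≡ᵇ ρ) ∧
                  any (λ a → any (λ b → (at P a ≡ᵇ π) ∧ (at P b ≡ᵇ π) ∧ (a ≤ᵇ i) ∧ (i ≤ᵇ b))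
                       ns) ns) ns
  where ns = upTo (length P)

-- subsets of the set of block labels {0,..,m-1}, as characteristic lists
subsets : ℕ → List (List Bool)
subsets zero    = [] ∷ []
subsets (suc m) = concatMap (λ S → (false ∷ S) ∷ (true ∷ S) ∷ []) (subsets m)

isLowerset : List ℕ → List Bool → Bool
isLowerset P S = all (λ π → all (λ ρ →
                   not (arrow P π ρ ∧ atB S ρ ∧ not (atB S π))) bs) bs
  where bs = upTo (nBlocks P)

-- the cuts (L,U) of P, given by their lowerset L
cutsOf : List ℕ → List (List Bool)
cutsOf P = filter (λ S → T? (isLowerset P S)) (subsets (nBlocks P))
  where open import Data.Bool.Properties using (T?)

lowerElems : List ℕ → List Bool → List ℕ
lowerElems P S = filter (λ i → T? (atB S (at P i))) (upTo (length P))
  where open import Data.Bool.Properties using (T?)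

-- the sets D₀,...,D_k (D₀ = [n] if k = 0); the argument is the exclusive
-- lower bound (nothing = no bound)
gapsFrom : ℕ → Maybe ℕ → List ℕ → List (List ℕ)
gapsFrom n lo []       = filter (λ y → T? (above lo y)) (upTo n) ∷ []
  where
  open import Data.Bool.Properties using (T?)
  above : Maybe ℕ → ℕ → Bool
  above nothing  y = true
  above (just x) y = x <ᵇ y
gapsFrom n lo (x ∷ xs) = filter (λ y → T? (above lo y ∧ (y <ᵇ x))) (upTo n)
                         ∷ gapsFrom n (just x) xs
  where
  open import Data.Bool.Properties using (T?)
  above : Maybe ℕ → ℕ → Bool
  above nothing  y = true
  above (just z) y = z <ᵇ y

-- the partition of the blocks of the lowerset (omitted, i.e. empty word, if L = ∅)
lowerPart : List ℕ → List Bool → List (List ℕ)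
lowerPart P S with lowerElems P S
... | []       = []
... | X@(_ ∷ _) = restrict P X ∷ []

gapMonomial : List ℕ → List Bool → List (List ℕ)
gapMonomial P S =
  map (restrict P)
      (filter (λ D → T? (nonEmpty D)) (gapsFrom (length P) nothing (lowerElems P S)))
  where open import Data.Bool.Properties using (T?)

-- The algebra H: basis words of letters (noncrossing partitions).

Word : Set
Word = List (List ℕ)

ValidWord : Word → Set
ValidWord w = T (all isNCP w)

wordCuts : Word → List (List (List Bool))
wordCuts []       = [] ∷ []
wordCuts (P ∷ w) = concatMap (λ S → map (S ∷_) (wordCuts w)) (cutsOf P)

cutLeft : Word → List (List Bool) → Word
cutLeft w cs = concat (zipWith lowerPart w cs)

cutRight : Word → List (List Bool) → Word
cutRight w cs = concat (zipWith gapMonomial w cs)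

-- the cuts appearing in Δ_≺ : the block containing 1 of P₁ (label 0) lies in L₁
precCuts : Word → List (List (List Bool))
precCuts w = filter (λ cs → T? (firstIn cs)) (wordCuts w)
  where
  open import Data.Bool.Properties using (T?)
  firstIn : List (List Bool) → Bool
  firstIn []       = false
  firstIn (S ∷ _) = atB S 0

module _ {c ℓ} (R : CommutativeRing c ℓ) where
  open CommutativeRing R

  -- linear forms on H are given by their values on basis words
  LinForm : Set c
  LinForm = Word → Carrier

  sumR : List Carrier → Carrier
  sumR = foldr _+_ 0#

  prodR : List Carrier → Carrier
  prodR = foldr _*_ 1#

  εH : LinForm
  εH []      = 1#
  εH (_ ∷ _) = 0#

  prec : LinForm → LinForm → LinForm
  prec f g []        = 0#
  prec f g w@(_ ∷ _) = sumR (map (λ cs → f (cutLeft w cs) * g (cutRight w cs)) (precCuts w))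

  -- κ is an infinitesimal character of H: vanishes on 1 and on
  -- (basis) products of two elements of H₊, i.e. on words of length ≠ 1
  IsInfChar : LinForm → Set ℓ
  IsInfChar κ = (κ [] ≈ 0#) ×
                (∀ P Q w → ValidWord (P ∷ Q ∷ w) → κ (P ∷ Q ∷ w) ≈ 0#)

  -- φ solves φ = ε_H + κ ≺ φ (on H); E_≺(κ) is the unique such φ
  IsExpPrec : LinForm → LinForm → Set ℓ
  IsExpPrec κ φ = ∀ w → ValidWord w → φ w ≈ εH w + prec κ φ w

  blockProd : (ℕ → Carrier) → List ℕ → Carrier
  blockProd k P = prodR (map (λ j → k (length (blockOf P j))) (upTo (nBlocks P)))

  coarser : List ℕ → List ℕ → Bool
  coarser Q P = all (λ i → all (λ j → not (at P i ≡ᵇ at P j) ∨ (at Q i ≡ᵇ at Q j)) ns) ns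
    where ns = upTo (length P)

  -- a character χ of A is given by its values on the generators NCP;
  -- χ(P/Q) = ∏_{τ ∈ Q} χ(P_{|τ})
  charQuot : (List ℕ → Carrier) → List ℕ → List ℕ → Carrier
  charQuot χ P Q = prodR (map (λ τ → χ (restrict P (blockOf Q τ))) (upTo (nBlocks Q)))

  -- (α ↶ χ)(P) = (α ⊗ χ) ρ(P) = Σ_{Q ∈ NCP(n), Q ≥ P} α(Q) χ(P/Q)
  actRight : LinForm → (List ℕ → Carrier) → List ℕ → Carrier
  actRight α χ P =
    sumR (map (λ Q → α (Q ∷ []) * charQuot χ P Q)
              (filter (λ Q → T? (coarser Q P)) (NCPs (length P))))
    where open import Data.Bool.Properties using (T?)

  ζ : List ℕ → Carrier
  ζ _ = 1#

-- Expand φ = ε + κ ≺ φ on a word P w of noncrossing partitions. The cuts of Δ_≺(P w) contribute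
-- κ(L₁⋯L_r) φ(M₁⋯M_r), and κ(L₁⋯L_r) vanishes unless L₁⋯L_r is a single letter I_m. Since the
-- lowerset of P contains the block π₁ of 1, this forces it to be exactly {π₁} (any further block
-- would give the restriction of P a second block) and the lowersets of the other letters to be
-- empty. That cut occurs once, so φ(P w) = k_{#π₁} φ(M w), where M is the gap monomial of π₁.
-- As P is noncrossing, every other block of P lies in a single gap of π₁, hence
--   ∏_{π∈P} k_{#π} = k_{#π₁} ∏_{Q∈M} ∏_{π∈Q} k_{#π},
-- and induction on the number of points gives φ(P₁⋯P_r) = ∏_i ∏_{π∈P_i} k_{#π}. For the second
-- identity, every Q ∈ NCP(n) lies above J_n and ζ(J_n/Q) = 1.

module Submission where

open import Defs
open import Algebra.Bundles using (CommutativeRing)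
import Data.Bool as Bool
open import Data.Bool using (Bool; true; false; _∧_; _∨_; not; if_then_else_; T)
open import Data.Bool.Properties using (T?; T-∧; T-≡; ∧-zeroʳ; ∧-identityʳ)
open import Data.Empty using (⊥; ⊥-elim)
open import Data.List using
  ( List; []; _∷_; [_]; map; length; upTo; applyUpTo; replicate; _++_; filterᵇ; concatMap)
open import Data.List.Properties using
  ( filter-≐; filter-all; filter-none; filter-accept; ∷-injectiveˡ; ∷-injectiveʳ; length-map;
    map-upTo; map-applyUpTo; length-upTo; upTo-∷ʳ; length-replicate; map-++; ++-conicalˡ;
    ++-conicalʳ; ≡-dec)
open import Data.List.Membership.Propositional using (_∈_; find)
open import Data.List.Membership.Propositional.Properties using
  ( ∈-upTo⁺; ∈-upTo⁻; ∈-filter⁺; ∈-filter⁻; ∈-map⁻; ∈-concatMap⁻)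
open import Data.List.Relation.Unary.All as All using (All; []; _∷_)
import Data.List.Relation.Unary.All.Properties as AllP
open import Data.List.Relation.Unary.AllPairs as AllPairs using (AllPairs; []; _∷_)
import Data.List.Relation.Unary.AllPairs.Properties as AllPairsₚ
open import Data.List.Relation.Unary.Any using (here; there)
open import Data.List.Relation.Binary.Pointwise using (Pointwise; []; _∷_)
open import Data.Maybe using (Maybe; just; nothing)
open import Data.Nat as ℕ using (ℕ; zero; suc; _≤_; _<_; z≤n; s≤s; _≡ᵇ_; _<ᵇ_; _≤ᵇ_; _⊔_; _∸_; pred)
open import Data.Nat.Properties using
  ( ≡ᵇ⇒≡; ≡⇒≡ᵇ; <ᵇ⇒<; <⇒<ᵇ; ≤ᵇ⇒≤; ≤⇒≤ᵇ; <-trans; <-irrefl; <-asym; <⇒≢; <⇒≤; ≤-refl;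
    ≤-reflexive; ≤-trans; n<1+n; n≤1+n; m≤n⇒m<n∨m≡n; +-suc; ⊔-identityʳ; ⊔-assoc; m≥n⇒m⊔n≡m;
    m≤n⇒m⊔n≡n; m≤m⊔n; m≤n⊔m; ∸-distribʳ-⊔; m≤n⇒m∸n≡0; +-∸-assoc; n∸n≡0; 0∸n≡0; ≤-total;
    m<n⇒m<1+n; m<n+m; +-monoˡ-<; <-≤-trans; ≤∧≢⇒<; ≮⇒≥; <-cmp; <⇒≯)
import Data.Nat.Properties as ℕₚ
open import Data.Nat.ListAction using (sum)
open import Data.Nat.ListAction.Properties using (sum-++)
open import Data.Product using (_×_; _,_; ∃; proj₁; proj₂)
open import Data.Sum using (_⊎_; inj₁; inj₂)
open import Data.Unit using (tt)
open import Function using (_∘_; id; case_of_)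
open import Function.Bundles using (Equivalence)
open import Relation.Nullary using (¬_; Dec; yes; no)
open import Relation.Binary using (DecidableEquality; tri<; tri≈; tri>)
open import Relation.Binary.PropositionalEquality using
  ( _≡_; _≢_; refl; sym; trans; cong; cong₂; subst; module ≡-Reasoning)

T-∧-intro : ∀ {a b} → T a → T b → T (a ∧ b)
T-∧-intro {a} {b} ta tb = Equivalence.from (T-∧ {a} {b}) (ta , tb)

T-∧ˡ : ∀ {a b} → T (a ∧ b) → T a
T-∧ˡ {a} {b} = proj₁ ∘ Equivalence.to (T-∧ {a} {b})

T-∧ʳ : ∀ {a b} → T (a ∧ b) → T b
T-∧ʳ {a} {b} = proj₂ ∘ Equivalence.to (T-∧ {a} {b})

T-not-elim : ∀ {a} → T (not a) → T a → ⊥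
T-not-elim {false} _ ()

T⇒≡true : ∀ {b} → T b → b ≡ true
T⇒≡true = Equivalence.to T-≡

≡true⇒T : ∀ {b} → b ≡ true → T b
≡true⇒T = Equivalence.from T-≡

≡ᵇ⇒≡′ : ∀ {m n} → T (m ≡ᵇ n) → m ≡ n
≡ᵇ⇒≡′ {m} {n} = ≡ᵇ⇒≡ m n

≡⇒≡ᵇ′ : ∀ {m n} → m ≡ n → T (m ≡ᵇ n)
≡⇒≡ᵇ′ {m} {n} = ≡⇒≡ᵇ m n

<ᵇ⇒<′ : ∀ {m n} → T (m <ᵇ n) → m < n
<ᵇ⇒<′ {m} {n} = <ᵇ⇒< m n

≢⇒≡ᵇ≡false : ∀ {m n} → m ≢ n → (m ≡ᵇ n) ≡ false
≢⇒≡ᵇ≡false {m} {n} m≢n with m ≡ᵇ n in eq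
... | true  = ⊥-elim (m≢n (≡ᵇ⇒≡ m n (≡true⇒T eq)))
... | false = refl

≡⇒≡ᵇ≡true : ∀ {m n} → m ≡ n → (m ≡ᵇ n) ≡ true
≡⇒≡ᵇ≡true {m} {n} m≡n = T⇒≡true (≡⇒≡ᵇ m n m≡n)

≮⇒<ᵇ≡false : ∀ {m n} → ¬ m < n → (m <ᵇ n) ≡ false
≮⇒<ᵇ≡false {m} {n} m≮n with m <ᵇ n in eq
... | true  = ⊥-elim (m≮n (<ᵇ⇒< m n (≡true⇒T eq)))
... | false = refl

module _ {A : Set} (p : A → Bool) where

  T-all⁻ : ∀ xs → T (all p xs) → ∀ {x} → x ∈ xs → T (p x)
  T-all⁻ (y ∷ ys) t (here refl) = T-∧ˡ t
  T-all⁻ (y ∷ ys) t (there x∈ys) = T-all⁻ ys (T-∧ʳ {p y} t) x∈ys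

  T-all⁺ : ∀ xs → (∀ {x} → x ∈ xs → T (p x)) → T (all p xs)
  T-all⁺ []       h = tt
  T-all⁺ (y ∷ ys) h = T-∧-intro (h (here refl)) (T-all⁺ ys (h ∘ there))

  T-any⁻ : ∀ xs → T (any p xs) → ∃ λ x → x ∈ xs × T (p x)
  T-any⁻ (y ∷ ys) t with p y in eq
  ... | true  = y , here refl , ≡true⇒T eq
  ... | false with T-any⁻ ys t
  ...   | x , x∈ys , px = x , there x∈ys , px

  length-filterᵇ : ∀ xs → length xs ≡ length (filterᵇ p xs) ℕ.+ length (filterᵇ (not ∘ p) xs)
  length-filterᵇ []       = refl
  length-filterᵇ (x ∷ xs) with p x
  ... | true  = cong suc (length-filterᵇ xs)
  ... | false = trans (cong suc (length-filterᵇ xs)) (sym (+-suc _ _))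

  filterᵇ-map : {B : Set} (f : B → A) → ∀ xs → filterᵇ p (map f xs) ≡ map f (filterᵇ (p ∘ f) xs)
  filterᵇ-map f []       = refl
  filterᵇ-map f (x ∷ xs) with p (f x)
  ... | true  = cong (f x ∷_) (filterᵇ-map f xs)
  ... | false = filterᵇ-map f xs

filterᵇ-cong : {A : Set} {p q : A → Bool} → ∀ xs → (∀ {x} → x ∈ xs → p x ≡ q x) → filterᵇ p xs ≡ filterᵇ q xs
filterᵇ-cong []                 h = refl
filterᵇ-cong {p = p} {q} (x ∷ xs) h with p x | q x | h (here refl)
... | true  | true  | _ = cong (x ∷_) (filterᵇ-cong xs (h ∘ there))
... | false | false | _ = filterᵇ-cong xs (h ∘ there)

filterᵇ-filterᵇ : {A : Set} (p q : A → Bool) → ∀ xs → filterᵇ q (filterᵇ p xs) ≡ filterᵇ (λ x → p x ∧ q x) xs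
filterᵇ-filterᵇ p q []       = refl
filterᵇ-filterᵇ p q (x ∷ xs) with p x
... | false = filterᵇ-filterᵇ p q xs
... | true with q x
...   | true  = cong (x ∷_) (filterᵇ-filterᵇ p q xs)
...   | false = filterᵇ-filterᵇ p q xs

Increasing : List ℕ → Set
Increasing = AllPairs _<_

upTo-increasing : ∀ n → Increasing (upTo n)
upTo-increasing n = AllPairsₚ.applyUpTo⁺₁ id n (λ i<j _ → i<j)

at-∈ : ∀ xs {a} → a < length xs → at xs a ∈ xs
at-∈ (x ∷ xs) {zero}  _       = here refl
at-∈ (x ∷ xs) {suc a} (s≤s l) = there (at-∈ xs l)

∈⇒at : ∀ xs {z} → z ∈ xs → ∃ λ a → a < length xs × at xs a ≡ z
∈⇒at (x ∷ xs) (here refl) = 0 , s≤s z≤n , refl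
∈⇒at (x ∷ xs) (there z∈xs) with ∈⇒at xs z∈xs
... | a , l , e = suc a , s≤s l , e

at-map : ∀ (f : ℕ → ℕ) xs {a} → a < length xs → at (map f xs) a ≡ f (at xs a)
at-map f (x ∷ xs) {zero}  _       = refl
at-map f (x ∷ xs) {suc a} (s≤s l) = at-map f xs l

at-applyUpTo : ∀ (f : ℕ → ℕ) n {i} → i < n → at (applyUpTo f n) i ≡ f i
at-applyUpTo f (suc n) {zero}  _       = refl
at-applyUpTo f (suc n) {suc i} (s≤s l) = at-applyUpTo (f ∘ suc) n l

at-upTo : ∀ n {i} → i < n → at (upTo n) i ≡ i
at-upTo = at-applyUpTo id

map-at-upTo : ∀ P → map (at P) (upTo (length P)) ≡ P
map-at-upTo []      = refl
map-at-upTo (x ∷ P) = cong (x ∷_) (trans (map-applyUpTo suc (at (x ∷ P)) (length P))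
                                  (trans (sym (map-upTo (at P) (length P))) (map-at-upTo P)))

Increasing-at-mono : ∀ {X} → Increasing X → ∀ {a b} → a < b → b < length X → at X a < at X b
Increasing-at-mono (x<xs ∷ _)  {zero}  {suc b} _        (s≤s l) = All.lookup x<xs (at-∈ _ l)
Increasing-at-mono (_ ∷ incr) {suc a} {suc b} (s≤s a<b) (s≤s l) = Increasing-at-mono incr a<b l

at-replicate-0 : ∀ m a → at (replicate m 0) a ≡ 0
at-replicate-0 zero    a       = refl
at-replicate-0 (suc m) zero    = refl
at-replicate-0 (suc m) (suc a) = at-replicate-0 m a

atB-replicate-false : ∀ m j → atB (replicate m false) j ≡ false
atB-replicate-false zero    j       = refl
atB-replicate-false (suc m) zero    = refl
atB-replicate-false (suc m) (suc j) = atB-replicate-false m j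

applyUpTo-cong : {A : Set} {f g : ℕ → A} → (∀ i → f i ≡ g i) → ∀ n → applyUpTo f n ≡ applyUpTo g n
applyUpTo-cong f≗g zero    = refl
applyUpTo-cong f≗g (suc n) = cong₂ _∷_ (f≗g 0) (applyUpTo-cong (f≗g ∘ suc) n)

occurrences : {A : Set} → DecidableEquality A → A → List A → ℕ
occurrences _≟_ x []       = 0
occurrences _≟_ x (y ∷ ys) with x ≟ y
... | yes _ = suc (occurrences _≟_ x ys)
... | no  _ = occurrences _≟_ x ys

module _ {A : Set} (_≟_ : DecidableEquality A) where

  occurrences-≡ : ∀ {x y} ys → x ≡ y → occurrences _≟_ x (y ∷ ys) ≡ suc (occurrences _≟_ x ys)
  occurrences-≡ {x} {y} ys x≡y with x ≟ y
  ... | yes _   = refl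
  ... | no  x≢y = ⊥-elim (x≢y x≡y)

  occurrences-≢ : ∀ {x y} ys → x ≢ y → occurrences _≟_ x (y ∷ ys) ≡ occurrences _≟_ x ys
  occurrences-≢ {x} {y} ys x≢y with x ≟ y
  ... | yes x≡y = ⊥-elim (x≢y x≡y)
  ... | no  _   = refl

  occurrences-++ : ∀ x xs ys → occurrences _≟_ x (xs ++ ys) ≡ occurrences _≟_ x xs ℕ.+ occurrences _≟_ x ys
  occurrences-++ x []       ys = refl
  occurrences-++ x (y ∷ xs) ys with x ≟ y
  ... | yes _ = cong suc (occurrences-++ x xs ys)
  ... | no  _ = occurrences-++ x xs ys

  occurrences-filterᵇ : ∀ (p : A → Bool) x xs → T (p x) → occurrences _≟_ x (filterᵇ p xs) ≡ occurrences _≟_ x xs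
  occurrences-filterᵇ p x []       px = refl
  occurrences-filterᵇ p x (y ∷ xs) px with p y in py
  ... | true with x ≟ y
  ...   | yes _ = cong suc (occurrences-filterᵇ p x xs px)
  ...   | no  _ = occurrences-filterᵇ p x xs px
  occurrences-filterᵇ p x (y ∷ xs) px | false with x ≟ y
  ...   | yes refl = ⊥-elim (subst T py px)
  ...   | no  _    = occurrences-filterᵇ p x xs px

module _ {A : Set} (_≟_ : DecidableEquality A) where
  private
    _≟ₗ_ : DecidableEquality (List A)
    _≟ₗ_ = ≡-dec _≟_

  occurrences-map-∷ : ∀ x xs W → occurrences _≟ₗ_ (x ∷ xs) (map (x ∷_) W) ≡ occurrences _≟ₗ_ xs W
  occurrences-map-∷ x xs []      = refl
  occurrences-map-∷ x xs (X ∷ W) = headOrNot (xs ≟ₗ X)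
    where
    headOrNot : Dec (xs ≡ X) → occurrences _≟ₗ_ (x ∷ xs) (map (x ∷_) (X ∷ W)) ≡ occurrences _≟ₗ_ xs (X ∷ W)
    headOrNot (yes refl) = trans (occurrences-≡ _≟ₗ_ (map (x ∷_) W) refl)
                                 (trans (cong suc (occurrences-map-∷ x xs W)) (sym (occurrences-≡ _≟ₗ_ W refl)))
    headOrNot (no xs≢X)  = trans (occurrences-≢ _≟ₗ_ (map (x ∷_) W) (xs≢X ∘ ∷-injectiveʳ))
                                 (trans (occurrences-map-∷ x xs W) (sym (occurrences-≢ _≟ₗ_ W xs≢X)))

  occurrences-map-∷-≢ : ∀ {x y} xs W → x ≢ y → occurrences _≟ₗ_ (x ∷ xs) (map (y ∷_) W) ≡ 0
  occurrences-map-∷-≢ xs []      x≢y = refl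
  occurrences-map-∷-≢ xs (X ∷ W) x≢y =
    trans (occurrences-≢ _≟ₗ_ (map (_ ∷_) W) (x≢y ∘ ∷-injectiveˡ)) (occurrences-map-∷-≢ xs W x≢y)

  occurrences-concatMap-∷ : ∀ x xs W L →
    occurrences _≟ₗ_ (x ∷ xs) (concatMap (λ y → map (y ∷_) W) L) ≡ occurrences _≟_ x L ℕ.* occurrences _≟ₗ_ xs W
  occurrences-concatMap-∷ x xs W []      = refl
  occurrences-concatMap-∷ x xs W (y ∷ L) =
    trans (occurrences-++ _≟ₗ_ (x ∷ xs) (map (y ∷_) W) (concatMap (λ y → map (y ∷_) W) L)) (headOrNot (x ≟ y))
    where
    headOrNot : Dec (x ≡ y) →
      occurrences _≟ₗ_ (x ∷ xs) (map (y ∷_) W) ℕ.+ occurrences _≟ₗ_ (x ∷ xs) (concatMap (λ y → map (y ∷_) W) L)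
                            ≡ occurrences _≟_ x (y ∷ L) ℕ.* occurrences _≟ₗ_ xs W
    headOrNot (yes refl) = trans (cong₂ ℕ._+_ (occurrences-map-∷ x xs W) (occurrences-concatMap-∷ x xs W L))
                                 (cong (ℕ._* occurrences _≟ₗ_ xs W) (sym (occurrences-≡ _≟_ L refl)))
    headOrNot (no x≢y)   = trans (cong₂ ℕ._+_ (occurrences-map-∷-≢ xs W x≢y) (occurrences-concatMap-∷ x xs W L))
                                 (cong (ℕ._* occurrences _≟ₗ_ xs W) (sym (occurrences-≢ _≟_ L x≢y)))

-- Standardization and restricted growth strings

indexOf-< : ∀ x s {i} → indexOf x s ≡ just i → i < length s
indexOf-< x (y ∷ s) e with x ≡ᵇ y
indexOf-< x (y ∷ s) refl | true = s≤s z≤n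
... | false with indexOf x s in eq
indexOf-< x (y ∷ s) refl | false | just j = s≤s (indexOf-< x s eq)

at-indexOf : ∀ x s {i} → indexOf x s ≡ just i → at s i ≡ x
at-indexOf x (y ∷ s) e with x ≡ᵇ y in eq
at-indexOf x (y ∷ s) refl | true = sym (≡ᵇ⇒≡′ (≡true⇒T eq))
... | false with indexOf x s in eq′
at-indexOf x (y ∷ s) refl | false | just j = at-indexOf x s eq′

indexOf-++ : ∀ x s t {i} → indexOf x s ≡ just i → indexOf x (s ++ t) ≡ just i
indexOf-++ x (y ∷ s) t e with x ≡ᵇ y
... | true = e
... | false with indexOf x s in eq
indexOf-++ x (y ∷ s) t refl | false | just j rewrite indexOf-++ x s t eq = refl

indexOf-∷ʳ-new : ∀ x s → indexOf x s ≡ nothing → indexOf x (s ++ [ x ]) ≡ just (length s)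
indexOf-∷ʳ-new x []      e rewrite ≡⇒≡ᵇ≡true {x} refl = refl
indexOf-∷ʳ-new x (y ∷ s) e with x ≡ᵇ y
... | false with indexOf x s in eq
... | nothing rewrite indexOf-∷ʳ-new x s eq = refl

indexOf-∷ʳ-other : ∀ x y s → indexOf x s ≡ nothing → x ≢ y → indexOf x (s ++ [ y ]) ≡ nothing
indexOf-∷ʳ-other x y []      e x≢y rewrite ≢⇒≡ᵇ≡false x≢y = refl
indexOf-∷ʳ-other x y (z ∷ s) e x≢y with x ≡ᵇ z
... | false with indexOf x s in eq
... | nothing rewrite indexOf-∷ʳ-other x y s eq x≢y = refl

length-∷ʳ : ∀ (s : List ℕ) x → length (s ++ [ x ]) ≡ suc (length s)
length-∷ʳ []      x = refl
length-∷ʳ (y ∷ s) x = cong suc (length-∷ʳ s x)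

seenLabels : List ℕ → List ℕ → List ℕ
seenLabels s []       = s
seenLabels s (x ∷ xs) with indexOf x s
... | just _  = seenLabels s xs
... | nothing = seenLabels (s ++ [ x ]) xs

indexOf-seenLabels : ∀ s ys x {i} → indexOf x s ≡ just i → indexOf x (seenLabels s ys) ≡ just i
indexOf-seenLabels s []       x e = e
indexOf-seenLabels s (y ∷ ys) x e with indexOf y s
... | just _  = indexOf-seenLabels s ys x e
... | nothing = indexOf-seenLabels (s ++ [ y ]) ys x (indexOf-++ x s [ y ] e)

seenLabels-complete : ∀ s ys {y} → y ∈ ys → ∃ λ i → indexOf y (seenLabels s ys) ≡ just i
seenLabels-complete s (x ∷ xs) (here refl) with indexOf x s in eq
... | just i  = i , indexOf-seenLabels s xs x eq
... | nothing = length s , indexOf-seenLabels (s ++ [ x ]) xs x (indexOf-∷ʳ-new x s eq)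
seenLabels-complete s (x ∷ xs) (there y∈xs) with indexOf x s
... | just _  = seenLabels-complete s xs y∈xs
... | nothing = seenLabels-complete (s ++ [ x ]) xs y∈xs

-- The junk value 0 for absent labels never matters: only present labels are looked up.
positionIn : List ℕ → ℕ → ℕ
positionIn L x with indexOf x L
... | just i  = i
... | nothing = 0

positionIn-just : ∀ L x {i} → indexOf x L ≡ just i → positionIn L x ≡ i
positionIn-just L x e with indexOf x L
positionIn-just L x refl | just i = refl

standardizeWith-map : ∀ s ys → standardizeWith s ys ≡ map (positionIn (seenLabels s ys)) ys
standardizeWith-map s []       = refl
standardizeWith-map s (x ∷ xs) with indexOf x s in eq
... | just i  = cong₂ _∷_ (sym (positionIn-just (seenLabels s xs) x (indexOf-seenLabels s xs x eq)))
                          (standardizeWith-map s xs)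
... | nothing = cong₂ _∷_ (sym (positionIn-just (seenLabels (s ++ [ x ]) xs) x
                                  (indexOf-seenLabels (s ++ [ x ]) xs x (indexOf-∷ʳ-new x s eq))))
                          (standardizeWith-map (s ++ [ x ]) xs)

positionIn-seenLabels-injective : ∀ s ys {u v} → u ∈ ys → v ∈ ys →
  positionIn (seenLabels s ys) u ≡ positionIn (seenLabels s ys) v → u ≡ v
positionIn-seenLabels-injective s ys {u} {v} u∈ys v∈ys e
  with seenLabels-complete s ys u∈ys | seenLabels-complete s ys v∈ys
... | i , eu | j , ev =
  trans (sym (at-indexOf u L eu))
        (trans (cong (at L) (trans (sym (positionIn-just L u eu)) (trans e (positionIn-just L v ev))))
               (at-indexOf v L ev))
  where L = seenLabels s ys

length-standardizeWith : ∀ s ys → length (standardizeWith s ys) ≡ length ys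
length-standardizeWith s ys = trans (cong length (standardizeWith-map s ys)) (length-map _ ys)

standardizeWith-reflects-≡ : ∀ s ys {a b} → a < length ys → b < length ys →
  at (standardizeWith s ys) a ≡ at (standardizeWith s ys) b → at ys a ≡ at ys b
standardizeWith-reflects-≡ s ys {a} {b} a<n b<n e =
  positionIn-seenLabels-injective s ys (at-∈ ys a<n) (at-∈ ys b<n)
    (trans (sym (at-map _ ys a<n))
           (trans (subst (λ z → at z a ≡ at z b) (standardizeWith-map s ys) e) (at-map _ ys b<n)))

standardizeWith-preserves-≡ : ∀ s ys {a b} → a < length ys → b < length ys →
  at ys a ≡ at ys b → at (standardizeWith s ys) a ≡ at (standardizeWith s ys) b
standardizeWith-preserves-≡ s ys {a} {b} a<n b<n e =
  subst (λ z → at z a ≡ at z b) (sym (standardizeWith-map s ys))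
    (trans (at-map _ ys a<n) (trans (cong (positionIn (seenLabels s ys)) e) (sym (at-map _ ys b<n))))

standardizeWith-rgs : ∀ s ys → T (rgsFrom (length s) (standardizeWith s ys))
standardizeWith-rgs s []       = tt
standardizeWith-rgs s (x ∷ xs) with indexOf x s in eq
... | just i rewrite ≢⇒≡ᵇ≡false (<⇒≢ (indexOf-< x s eq)) =
  T-∧-intro (≤⇒≤ᵇ (<⇒≤ (indexOf-< x s eq))) (standardizeWith-rgs s xs)
... | nothing rewrite ≡⇒≡ᵇ≡true {length s} refl =
  T-∧-intro (≤⇒≤ᵇ (≤-refl {length s}))
            (subst (λ m → T (rgsFrom m (standardizeWith (s ++ [ x ]) xs))) (length-∷ʳ s x)
                   (standardizeWith-rgs (s ++ [ x ]) xs))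

indexOf-upTo-< : ∀ m {x} → x < m → indexOf x (upTo m) ≡ just x
indexOf-upTo-≥ : ∀ m {x} → m ≤ x → indexOf x (upTo m) ≡ nothing
indexOf-upTo-< (suc m) {x} x<1+m =
  subst (λ L → indexOf x L ≡ just x) (upTo-∷ʳ m) (lastOrEarlier (m≤n⇒m<n∨m≡n (ℕₚ.≤-pred x<1+m)))
  where
  lastOrEarlier : x < m ⊎ x ≡ m → indexOf x (upTo m ++ [ m ]) ≡ just x
  lastOrEarlier (inj₁ x<m)  = indexOf-++ x (upTo m) [ m ] (indexOf-upTo-< m x<m)
  lastOrEarlier (inj₂ refl) = trans (indexOf-∷ʳ-new x (upTo x) (indexOf-upTo-≥ x ≤-refl))
                                    (cong just (length-upTo x))
indexOf-upTo-≥ zero    _   = refl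
indexOf-upTo-≥ (suc m) {x} 1+m≤x = subst (λ L → indexOf x L ≡ nothing) (upTo-∷ʳ m)
  (indexOf-∷ʳ-other x m (upTo m) (indexOf-upTo-≥ m (<⇒≤ 1+m≤x)) (λ e → <⇒≢ 1+m≤x (sym e)))

standardizeWith-upTo-rgs : ∀ m ys → T (rgsFrom m ys) → standardizeWith (upTo m) ys ≡ ys
standardizeWith-upTo-rgs m []       t = refl
standardizeWith-upTo-rgs m (y ∷ ys) t with m≤n⇒m<n∨m≡n (≤ᵇ⇒≤ y m (T-∧ˡ t))
... | inj₁ y<m rewrite indexOf-upTo-< m y<m | ≢⇒≡ᵇ≡false (<⇒≢ y<m) =
  cong (y ∷_) (standardizeWith-upTo-rgs m ys (T-∧ʳ {y ≤ᵇ m} t))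
... | inj₂ refl rewrite indexOf-upTo-≥ y (≤-refl {y}) | ≡⇒≡ᵇ≡true {y} refl =
  cong₂ _∷_ (length-upTo y)
    (trans (cong (λ z → standardizeWith z ys) (upTo-∷ʳ y))
           (standardizeWith-upTo-rgs (suc y) ys (T-∧ʳ {y ≤ᵇ y} t)))

standardize-rgs : ∀ P → T (isRGS P) → standardizeWith [] P ≡ P
standardize-rgs = standardizeWith-upTo-rgs 0

rgs-head≡0 : ∀ {x xs} → T (isRGS (x ∷ xs)) → x ≡ 0
rgs-head≡0 {zero} _ = refl

rgsFrom-label-∈ : ∀ m ys → T (rgsFrom m ys) → ∀ {j} → m ≤ j → j < m ⊔ nBlocks ys → j ∈ ys
rgsFrom-label-∈ m [] t {j} m≤j j<m = ⊥-elim (<-irrefl refl (≤-trans j<m (≤-trans (≤-reflexive (⊔-identityʳ m)) m≤j)))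
rgsFrom-label-∈ m (y ∷ ys) t {j} m≤j j< with m≤n⇒m<n∨m≡n (≤ᵇ⇒≤ y m (T-∧ˡ t))
... | inj₁ y<m rewrite ≢⇒≡ᵇ≡false (<⇒≢ y<m) =
  there (rgsFrom-label-∈ m ys (T-∧ʳ {y ≤ᵇ m} t) m≤j (subst (j <_) old-bound j<))
  where
  old-bound : m ⊔ (suc y ⊔ nBlocks ys) ≡ m ⊔ nBlocks ys
  old-bound = trans (sym (⊔-assoc m (suc y) (nBlocks ys))) (cong (_⊔ nBlocks ys) (m≥n⇒m⊔n≡m y<m))
... | inj₂ refl rewrite ≡⇒≡ᵇ≡true {y} refl with m≤n⇒m<n∨m≡n m≤j
...   | inj₂ refl = here refl
...   | inj₁ y<j  = there (rgsFrom-label-∈ (suc y) ys (T-∧ʳ {y ≤ᵇ y} t) y<j (subst (j <_) new-bound j<))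
  where
  new-bound : y ⊔ (suc y ⊔ nBlocks ys) ≡ suc y ⊔ nBlocks ys
  new-bound = trans (sym (⊔-assoc y (suc y) (nBlocks ys))) (cong (_⊔ nBlocks ys) (m≤n⇒m⊔n≡n (n≤1+n y)))

rgs-label-occurs : ∀ P → T (isRGS P) → ∀ {j} → j < nBlocks P → ∃ λ i → i < length P × at P i ≡ j
rgs-label-occurs P t j<nP = ∈⇒at P (rgsFrom-label-∈ 0 P t z≤n j<nP)

at<nBlocks : ∀ P {i} → i < length P → at P i < nBlocks P
at<nBlocks (x ∷ P) {zero}  _       = m≤m⊔n (suc x) (nBlocks P)
at<nBlocks (x ∷ P) {suc i} (s≤s l) = ≤-trans (at<nBlocks P l) (m≤n⊔m (suc x) (nBlocks P))

standardize-replicate-0 : ∀ m → standardizeWith [] (replicate m 0) ≡ replicate m 0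
standardize-replicate-0 zero    = refl
standardize-replicate-0 (suc m) = cong (0 ∷_) (seen0 m)
  where
  seen0 : ∀ m → standardizeWith (0 ∷ []) (replicate m 0) ≡ replicate m 0
  seen0 zero    = refl
  seen0 (suc m) = cong (0 ∷_) (seen0 m)

-- Noncrossing partitions

NonCrossing : List ℕ → Set
NonCrossing P = ∀ {a c b d} → a < c → c < b → b < d → d < length P →
  at P a ≡ at P b → at P c ≡ at P d → at P a ≡ at P c

nonCrossing⇒NonCrossing : ∀ P → T (nonCrossing P) → NonCrossing P
nonCrossing⇒NonCrossing P t {a} {c} {b} {d} a<c c<b b<d d<n eab ecd =
  ≡ᵇ⇒≡′ (forced (T-all⁻ _ ns (T-all⁻ _ ns (T-all⁻ _ ns (T-all⁻ _ ns t (∈-upTo⁺ a<n)) (∈-upTo⁺ c<n))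
                                 (∈-upTo⁺ b<n)) (∈-upTo⁺ d<n))
     (<⇒<ᵇ a<c) (<⇒<ᵇ c<b) (<⇒<ᵇ b<d) (≡⇒≡ᵇ′ eab) (≡⇒≡ᵇ′ ecd))
  where
  ns = upTo (length P)
  b<n = <-trans b<d d<n
  c<n = <-trans c<b b<n
  a<n = <-trans a<c c<n
  forced : ∀ {u₁ u₂ u₃ u₄ u₅ u₆} → T (not (u₁ ∧ u₂ ∧ u₃ ∧ u₄ ∧ u₅ ∧ not u₆)) →
    T u₁ → T u₂ → T u₃ → T u₄ → T u₅ → T u₆
  forced {true} {true} {true} {true} {true} {true} _ _ _ _ _ _ = tt

NonCrossing⇒nonCrossing : ∀ P → NonCrossing P → T (nonCrossing P)
NonCrossing⇒nonCrossing P nc =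
  T-all⁺ _ ns λ {a} _ → T-all⁺ _ ns λ {c} _ → T-all⁺ _ ns λ {b} _ → T-all⁺ _ ns λ {d} d∈ →
    excluded {a <ᵇ c} {c <ᵇ b} {b <ᵇ d} {at P a ≡ᵇ at P b} {at P c ≡ᵇ at P d} {at P a ≡ᵇ at P c}
      (λ a<c c<b b<d eab ecd →
        ≡⇒≡ᵇ′ (nc (<ᵇ⇒<′ a<c) (<ᵇ⇒<′ c<b) (<ᵇ⇒<′ b<d) (∈-upTo⁻ d∈) (≡ᵇ⇒≡′ eab) (≡ᵇ⇒≡′ ecd)))
  where
  ns = upTo (length P)
  excluded : ∀ {u₁ u₂ u₃ u₄ u₅ u₆} → (T u₁ → T u₂ → T u₃ → T u₄ → T u₅ → T u₆) →
    T (not (u₁ ∧ u₂ ∧ u₃ ∧ u₄ ∧ u₅ ∧ not u₆))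
  excluded {false} h = tt
  excluded {true} {false} h = tt
  excluded {true} {true} {false} h = tt
  excluded {true} {true} {true} {false} h = tt
  excluded {true} {true} {true} {true} {false} h = tt
  excluded {true} {true} {true} {true} {true} {false} h = h tt tt tt tt tt
  excluded {true} {true} {true} {true} {true} {true} h = tt

isNCP⇒isRGS : ∀ P → IsNCP P → T (isRGS P)
isNCP⇒isRGS P t = T-∧ˡ (T-∧ʳ {nonEmpty P} t)

isNCP⇒NonCrossing : ∀ P → IsNCP P → NonCrossing P
isNCP⇒NonCrossing P t = nonCrossing⇒NonCrossing P (T-∧ʳ {isRGS P} (T-∧ʳ {nonEmpty P} t))

module _ (P X : List ℕ) where
  private
    inLabels : ∀ {a} → a < length X → a < length (map (at P) X)
    inLabels {a} = subst (a <_) (sym (length-map (at P) X))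

  length-restrict : length (restrict P X) ≡ length X
  length-restrict = trans (length-standardizeWith [] (map (at P) X)) (length-map (at P) X)

  restrict-reflects-≡ : ∀ {a b} → a < length X → b < length X →
    at (restrict P X) a ≡ at (restrict P X) b → at P (at X a) ≡ at P (at X b)
  restrict-reflects-≡ a<n b<n e =
    trans (sym (at-map (at P) X a<n))
          (trans (standardizeWith-reflects-≡ [] (map (at P) X) (inLabels a<n) (inLabels b<n) e) (at-map (at P) X b<n))

  restrict-preserves-≡ : ∀ {a b} → a < length X → b < length X →
    at P (at X a) ≡ at P (at X b) → at (restrict P X) a ≡ at (restrict P X) b
  restrict-preserves-≡ a<n b<n e =
    standardizeWith-preserves-≡ [] (map (at P) X) (inLabels a<n) (inLabels b<n)
      (trans (at-map (at P) X a<n) (trans e (sym (at-map (at P) X b<n))))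

restrict-isNCP : ∀ P → IsNCP P → ∀ {X} → X ≢ [] → Increasing X → All (_< length P) X →
  IsNCP (restrict P X)
restrict-isNCP P t {[]}    X≢[] _    _   = ⊥-elim (X≢[] refl)
restrict-isNCP P t {X@(x ∷ xs)} _ incr X<n =
  T-∧-intro {nonEmpty R} tt (T-∧-intro (standardizeWith-rgs [] (map (at P) X)) (NonCrossing⇒nonCrossing R ncR))
  where
  R = restrict P X
  inX : ∀ {a} → a < length R → a < length X
  inX {a} = subst (a <_) (length-restrict P X)
  ncR : NonCrossing R
  ncR {a} {c} {b} {d} a<c c<b b<d d<n eab ecd =
    restrict-preserves-≡ P X (inX a<n) (inX c<n)
      (isNCP⇒NonCrossing P t (Increasing-at-mono incr a<c (inX c<n)) (Increasing-at-mono incr c<b (inX b<n))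
         (Increasing-at-mono incr b<d (inX d<n)) (All.lookup X<n (at-∈ X (inX d<n)))
         (restrict-reflects-≡ P X (inX a<n) (inX b<n) eab) (restrict-reflects-≡ P X (inX c<n) (inX d<n) ecd))
    where
    b<n = <-trans b<d d<n
    c<n = <-trans c<b b<n
    a<n = <-trans a<c c<n

isNCP⇒0<length : ∀ P → IsNCP P → 0 < length P
isNCP⇒0<length (_ ∷ _) _ = s≤s z≤n

isNCP⇒at0≡0 : ∀ P → IsNCP P → at P 0 ≡ 0
isNCP⇒at0≡0 (x ∷ P) t = rgs-head≡0 {x} {P} (isNCP⇒isRGS (x ∷ P) t)

restrict-filterᵇ-isNCP : ∀ P → IsNCP P → ∀ q → filterᵇ q (upTo (length P)) ≢ [] →
  IsNCP (restrict P (filterᵇ q (upTo (length P))))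
restrict-filterᵇ-isNCP P t q ne =
  restrict-isNCP P t ne (AllPairsₚ.filter⁺ (T? ∘ q) (upTo-increasing (length P)))
    (All.tabulate (λ z∈ → ∈-upTo⁻ (proj₁ (∈-filter⁻ (T? ∘ q) z∈))))

module RingSums {c ℓ} (R : CommutativeRing c ℓ) where
  open CommutativeRing R renaming (refl to ≈-refl; sym to ≈-sym; trans to ≈-trans)
  open import Algebra.Properties.Monoid.Mult +-monoid using (×-homo-1) renaming (_×_ to _·_)

  prodR-++ : ∀ xs ys → prodR R (xs ++ ys) ≈ prodR R xs * prodR R ys
  prodR-++ []       ys = ≈-sym (*-identityˡ _)
  prodR-++ (x ∷ xs) ys = ≈-trans (*-congˡ (prodR-++ xs ys)) (≈-sym (*-assoc _ _ _))

  module _ {A : Set} {f g : A → Carrier} where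

    prodR-cong : ∀ xs → (∀ {x} → x ∈ xs → f x ≈ g x) → prodR R (map f xs) ≈ prodR R (map g xs)
    prodR-cong []       h = ≈-refl
    prodR-cong (x ∷ xs) h = *-cong (h (here refl)) (prodR-cong xs (h ∘ there))

    sumR-cong : ∀ xs → (∀ {x} → x ∈ xs → f x ≈ g x) → sumR R (map f xs) ≈ sumR R (map g xs)
    sumR-cong []       h = ≈-refl
    sumR-cong (x ∷ xs) h = +-cong (h (here refl)) (sumR-cong xs (h ∘ there))

  prodR-≈1 : {A : Set} (f : A → Carrier) → ∀ xs → (∀ {x} → x ∈ xs → f x ≈ 1#) → prodR R (map f xs) ≈ 1#
  prodR-≈1 f []       h = ≈-refl
  prodR-≈1 f (x ∷ xs) h = ≈-trans (*-cong (h (here refl)) (prodR-≈1 f xs (h ∘ there))) (*-identityˡ _)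

  module _ {A : Set} (_≟_ : DecidableEquality A) (x₀ : A) (g : A → Carrier) where

    sumR-supported : ∀ xs → (∀ {x} → x ∈ xs → x ≢ x₀ → g x ≈ 0#) →
      sumR R (map g xs) ≈ occurrences _≟_ x₀ xs · g x₀
    sumR-supported []       h = ≈-refl
    sumR-supported (x ∷ xs) h with x₀ ≟ x
    ... | yes refl = +-congˡ (sumR-supported xs (h ∘ there))
    ... | no x₀≢x  = ≈-trans (+-cong (h (here refl) (x₀≢x ∘ sym)) (sumR-supported xs (h ∘ there)))
                             (+-identityˡ _)

    sumR-supported-once : ∀ xs → (∀ {x} → x ∈ xs → x ≢ x₀ → g x ≈ 0#) → occurrences _≟_ x₀ xs ≡ 1 →
      sumR R (map g xs) ≈ g x₀
    sumR-supported-once xs h once =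
      ≈-trans (sumR-supported xs h) (≈-trans (reflexive (cong (_· g x₀) once)) (×-homo-1 (g x₀)))

-- Block products of a labelling

multiplicity : ℕ → List ℕ → ℕ
multiplicity x ys = length (filterᵇ (_≡ᵇ x) ys)

length-blockOf : ∀ P j → length (blockOf P j) ≡ multiplicity j P
length-blockOf P j = begin
  length (blockOf P j)                                      ≡⟨ cong length (filter-≐ _ _ (≡⇒≡ᵇ′ , ≡ᵇ⇒≡′) ns) ⟩
  length (filterᵇ (λ i → at P i ≡ᵇ j) ns)                   ≡⟨ sym (length-map (at P) (filterᵇ (λ i → at P i ≡ᵇ j) ns)) ⟩
  length (map (at P) (filterᵇ (λ i → at P i ≡ᵇ j) ns))      ≡⟨ cong length (sym (filterᵇ-map (_≡ᵇ j) (at P) ns)) ⟩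
  length (filterᵇ (_≡ᵇ j) (map (at P) ns))                  ≡⟨ cong (multiplicity j) (map-at-upTo P) ⟩
  multiplicity j P                                          ∎
  where
  open ≡-Reasoning
  ns = upTo (length P)

[1+y⊔b]∸m≡b∸m : ∀ y m b → suc y ≤ m → (suc y ⊔ b) ∸ m ≡ b ∸ m
[1+y⊔b]∸m≡b∸m y m b 1+y≤m = trans (∸-distribʳ-⊔ m (suc y) b) (cong (_⊔ (b ∸ m)) (m≤n⇒m∸n≡0 1+y≤m))

[1+m⊔b]∸m≡1+[b∸1+m] : ∀ m b → (suc m ⊔ b) ∸ m ≡ suc (b ∸ suc m)
[1+m⊔b]∸m≡1+[b∸1+m] m b with ≤-total b (suc m)
... | inj₁ b≤1+m = trans (cong (_∸ m) (m≥n⇒m⊔n≡m b≤1+m))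
                         (trans (+-∸-assoc 1 (≤-refl {m}))
                                (cong suc (trans (n∸n≡0 m) (sym (m≤n⇒m∸n≡0 b≤1+m)))))
... | inj₂ 1+m≤b = trans (cong (_∸ m) (m≤n⇒m⊔n≡n 1+m≤b)) (+-∸-assoc 1 1+m≤b)

multiplicity-filterᵇ : ∀ (f : ℕ → ℕ) (q : ℕ → Bool) v zs → (∀ {a} → a ∈ zs → f a ≡ v → T (q a)) →
  multiplicity v (map f (filterᵇ q zs)) ≡ multiplicity v (map f zs)
multiplicity-filterᵇ f q v []       h = refl
multiplicity-filterᵇ f q v (z ∷ zs) h with q z in qz
... | true with f z ≡ᵇ v
...   | true  = cong suc (multiplicity-filterᵇ f q v zs (h ∘ there))
...   | false = multiplicity-filterᵇ f q v zs (h ∘ there)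
multiplicity-filterᵇ f q v (z ∷ zs) h | false with f z ≡ᵇ v in fz
...   | true  = ⊥-elim (subst T qz (h (here refl) (≡ᵇ⇒≡′ (≡true⇒T fz))))
...   | false = multiplicity-filterᵇ f q v zs (h ∘ there)

multiplicity-replicate : ∀ m → multiplicity 0 (replicate m 0) ≡ m
multiplicity-replicate zero    = refl
multiplicity-replicate (suc m) = cong suc (multiplicity-replicate m)

module _ (g : ℕ → ℕ) (U : List ℕ) (g-inj : ∀ {u v} → u ∈ U → v ∈ U → g u ≡ g v → u ≡ v) where

  ≡ᵇ-injective : ∀ {a b} → a ∈ U → b ∈ U → (g a ≡ᵇ g b) ≡ (a ≡ᵇ b)
  ≡ᵇ-injective {a} {b} a∈U b∈U with a ℕ.≟ b
  ... | yes refl = trans (≡⇒≡ᵇ≡true {g a} refl) (sym (≡⇒≡ᵇ≡true {a} refl))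
  ... | no a≢b   = trans (≢⇒≡ᵇ≡false (a≢b ∘ g-inj a∈U b∈U)) (sym (≢⇒≡ᵇ≡false a≢b))

  elemᵇ-map : ∀ {x} seen → x ∈ U → All (_∈ U) seen → elemᵇ (g x) (map g seen) ≡ elemᵇ x seen
  elemᵇ-map []         x∈U []             = refl
  elemᵇ-map (y ∷ seen) x∈U (y∈U ∷ seen⊆U) = cong₂ _∨_ (≡ᵇ-injective x∈U y∈U) (elemᵇ-map seen x∈U seen⊆U)

  multiplicity-map : ∀ {x} F → x ∈ U → All (_∈ U) F → multiplicity (g x) (map g F) ≡ multiplicity x F
  multiplicity-map {x} F x∈U F⊆U = begin
    length (filterᵇ (_≡ᵇ g x) (map g F))          ≡⟨ cong length (filterᵇ-map (_≡ᵇ g x) g F) ⟩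
    length (map g (filterᵇ (λ y → g y ≡ᵇ g x) F)) ≡⟨ length-map g (filterᵇ (λ y → g y ≡ᵇ g x) F) ⟩
    length (filterᵇ (λ y → g y ≡ᵇ g x) F)         ≡⟨ cong length (filterᵇ-cong F (λ y∈F → ≡ᵇ-injective (All.lookup F⊆U y∈F) x∈U)) ⟩
    multiplicity x F                              ∎
    where open ≡-Reasoning

record SameFactor (v : ℕ) (F seen F′ seen′ : List ℕ) : Set where
  constructor sameFactor
  field
    same-seen : elemᵇ v seen ≡ elemᵇ v seen′
    same-mult : multiplicity v F ≡ multiplicity v F′

SameFactor-∷ : ∀ {v F seen F′ seen′} u → SameFactor v F seen F′ seen′ → SameFactor v F (u ∷ seen) F′ (u ∷ seen′)
SameFactor-∷ {v} u (sameFactor same-seen same-mult) = sameFactor (cong ((v ≡ᵇ u) ∨_) same-seen) same-mult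

SameFactor-∷ˡ : ∀ {v F seen F′ seen′ u} → v ≢ u → SameFactor v F seen F′ seen′ →
  SameFactor v F (u ∷ seen) F′ seen′
SameFactor-∷ˡ {v} {seen = seen} v≢u (sameFactor same-seen same-mult) =
  sameFactor (trans (cong (_∨ elemᵇ v seen) (≢⇒≡ᵇ≡false v≢u)) same-seen) same-mult

module KernelBlockProduct {c ℓ} (R : CommutativeRing c ℓ) (k : ℕ → CommutativeRing.Carrier R) where
  open CommutativeRing R renaming (refl to ≈-refl; sym to ≈-sym; trans to ≈-trans)
  open RingSums R
  open import Algebra.Properties.CommutativeSemigroup *-commutativeSemigroup using (x∙yz≈y∙xz)
  open import Relation.Binary.Reasoning.Setoid setoid

  -- kernelBlockProd ys is the product of k (#β) over the blocks β of the kernel of ys (the sets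
  -- of positions sharing a label). In kernelBlockProdFrom F seen, F is the whole labelling and
  -- seen the labels already met, so that each block is counted at its first position.
  blockFactor : List ℕ → List ℕ → ℕ → Carrier
  blockFactor F seen x = if elemᵇ x seen then 1# else k (multiplicity x F)

  blockFactor-cong : ∀ {v F seen F′ seen′} → SameFactor v F seen F′ seen′ →
    blockFactor F seen v ≡ blockFactor F′ seen′ v
  blockFactor-cong (sameFactor same-seen same-mult) = cong₂ (λ b n → if b then 1# else k n) same-seen same-mult

  kernelBlockProdFrom : List ℕ → List ℕ → List ℕ → Carrier
  kernelBlockProdFrom F seen []       = 1#
  kernelBlockProdFrom F seen (x ∷ xs) = blockFactor F seen x * kernelBlockProdFrom F (x ∷ seen) xs

  kernelBlockProd : List ℕ → Carrier
  kernelBlockProd ys = kernelBlockProdFrom ys [] ys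

  kernelBlockProdFrom-rgs : ∀ F m seen ys → T (rgsFrom m ys) → (∀ x → elemᵇ x seen ≡ (x <ᵇ m)) →
    kernelBlockProdFrom F seen ys
      ≈ prodR R (map (λ j → k (multiplicity j F)) (applyUpTo (m ℕ.+_) (nBlocks ys ∸ m)))
  kernelBlockProdFrom-rgs F m seen [] t seen≡<m rewrite 0∸n≡0 m = ≈-refl
  kernelBlockProdFrom-rgs F m seen (y ∷ ys) t seen≡<m with m≤n⇒m<n∨m≡n (≤ᵇ⇒≤ y m (T-∧ˡ t))
  ... | inj₁ y<m
    rewrite ≢⇒≡ᵇ≡false (<⇒≢ y<m) | seen≡<m y | [1+y⊔b]∸m≡b∸m y m (nBlocks ys) y<m | T⇒≡true (<⇒<ᵇ y<m) =
    ≈-trans (*-identityˡ _) (kernelBlockProdFrom-rgs F m (y ∷ seen) ys (T-∧ʳ {y ≤ᵇ m} t) seen′≡<m)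
    where
    seen′≡<m : ∀ x → elemᵇ x (y ∷ seen) ≡ (x <ᵇ m)
    seen′≡<m x with x ℕ.≟ y
    ... | yes refl rewrite ≡⇒≡ᵇ≡true {x} refl = sym (T⇒≡true (<⇒<ᵇ y<m))
    ... | no x≢y   rewrite ≢⇒≡ᵇ≡false x≢y = seen≡<m x
  ... | inj₂ refl
    rewrite ≡⇒≡ᵇ≡true {y} refl | seen≡<m y | [1+m⊔b]∸m≡1+[b∸1+m] y (nBlocks ys) | ≮⇒<ᵇ≡false (<-irrefl {y} refl) =
    *-cong (reflexive (cong (λ z → k (multiplicity z F)) (sym (ℕₚ.+-identityʳ y))))
      (≈-trans (kernelBlockProdFrom-rgs F (suc y) (y ∷ seen) ys (T-∧ʳ {y ≤ᵇ y} t) seen′≡<1+y)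
         (reflexive (cong (λ l → prodR R (map (λ j → k (multiplicity j F)) l))
            (applyUpTo-cong (λ i → sym (+-suc y i)) (nBlocks ys ∸ suc y)))))
    where
    seen′≡<1+y : ∀ x → elemᵇ x (y ∷ seen) ≡ (x <ᵇ suc y)
    seen′≡<1+y x with x ℕ.≟ y
    ... | yes refl rewrite ≡⇒≡ᵇ≡true {x} refl = sym (T⇒≡true (<⇒<ᵇ (n<1+n x)))
    ... | no x≢y rewrite ≢⇒≡ᵇ≡false x≢y | seen≡<m x with x <ᵇ y in e₁ | x <ᵇ suc y in e₂
    ...   | true  | true  = refl
    ...   | false | false = refl
    ...   | true  | false = ⊥-elim (subst T e₂ (<⇒<ᵇ (m<n⇒m<1+n (<ᵇ⇒< x y (≡true⇒T e₁)))))
    ...   | false | true  =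
      ⊥-elim (subst T e₁ (<⇒<ᵇ (≤∧≢⇒< (ℕₚ.≤-pred (<ᵇ⇒< x (suc y) (≡true⇒T e₂))) x≢y)))

  blockProd≈kernelBlockProd : ∀ P → T (isRGS P) → blockProd R k P ≈ kernelBlockProd P
  blockProd≈kernelBlockProd P t =
    ≈-trans (prodR-cong (upTo (nBlocks P)) (λ {j} _ → reflexive (cong k (length-blockOf P j))))
            (≈-sym (kernelBlockProdFrom-rgs P 0 [] P t (λ _ → refl)))

  module _ (g : ℕ → ℕ) (U : List ℕ) (g-inj : ∀ {u v} → u ∈ U → v ∈ U → g u ≡ g v → u ≡ v) where

    kernelBlockProdFrom-map : ∀ F seen ys → All (_∈ U) F → All (_∈ U) seen → All (_∈ U) ys →
      kernelBlockProdFrom (map g F) (map g seen) (map g ys) ≡ kernelBlockProdFrom F seen ys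
    kernelBlockProdFrom-map F seen []       F⊆U seen⊆U []            = refl
    kernelBlockProdFrom-map F seen (y ∷ ys) F⊆U seen⊆U (y∈U ∷ ys⊆U) =
      cong₂ _*_ (cong₂ (λ b n → if b then 1# else k n) (elemᵇ-map g U g-inj seen y∈U seen⊆U)
                                                     (multiplicity-map g U g-inj F y∈U F⊆U))
                (kernelBlockProdFrom-map F (y ∷ seen) ys F⊆U (y∈U ∷ seen⊆U) ys⊆U)

  kernelBlockProd-standardize : ∀ ys → kernelBlockProd (standardizeWith [] ys) ≡ kernelBlockProd ys
  kernelBlockProd-standardize ys =
    trans (cong kernelBlockProd (standardizeWith-map [] ys))
          (kernelBlockProdFrom-map _ ys (positionIn-seenLabels-injective [] ys) ys [] ys ys⊆ys [] ys⊆ys)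
    where
    ys⊆ys : All (_∈ ys) ys
    ys⊆ys = All.tabulate id

  blockProd-restrict : ∀ P D → blockProd R k (restrict P D) ≈ kernelBlockProd (map (at P) D)
  blockProd-restrict P D =
    ≈-trans (blockProd≈kernelBlockProd (restrict P D) (standardizeWith-rgs [] (map (at P) D)))
            (reflexive (kernelBlockProd-standardize (map (at P) D)))

  kernelBlockProdFrom-split : ∀ (f : ℕ → ℕ) (q : ℕ → Bool) zs F F₁ F₂ seen seen₁ seen₂ →
    (∀ {a b} → a ∈ zs → b ∈ zs → f a ≡ f b → q a ≡ q b) →
    (∀ {z} → z ∈ zs → T (q z) → SameFactor (f z) F seen F₁ seen₁) →
    (∀ {z} → z ∈ zs → T (not (q z)) → SameFactor (f z) F seen F₂ seen₂) →
    kernelBlockProdFrom F seen (map f zs)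
      ≈ kernelBlockProdFrom F₁ seen₁ (map f (filterᵇ q zs)) * kernelBlockProdFrom F₂ seen₂ (map f (filterᵇ (not ∘ q) zs))
  kernelBlockProdFrom-split f q []       F F₁ F₂ seen seen₁ seen₂ closed same₁ same₂ = ≈-sym (*-identityˡ _)
  kernelBlockProdFrom-split f q (z ∷ zs) F F₁ F₂ seen seen₁ seen₂ closed same₁ same₂ with q z in qz
  ... | true = begin
      blockFactor F seen (f z) * kernelBlockProdFrom F (f z ∷ seen) (map f zs)
    ≈⟨ *-congˡ (kernelBlockProdFrom-split f q zs F F₁ F₂ (f z ∷ seen) (f z ∷ seen₁) seen₂ closed′
                 (λ w∈ qw → SameFactor-∷ (f z) (same₁ (there w∈) qw))
                 (λ w∈ ¬qw → SameFactor-∷ˡ (separated w∈ ¬qw) (same₂ (there w∈) ¬qw))) ⟩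
      blockFactor F seen (f z) * (G₁ * G₂)
    ≈⟨ ≈-sym (*-assoc _ _ _) ⟩
      (blockFactor F seen (f z) * G₁) * G₂
    ≡⟨ cong (λ a → (a * G₁) * G₂) (blockFactor-cong (same₁ (here refl) (≡true⇒T qz))) ⟩
      (blockFactor F₁ seen₁ (f z) * G₁) * G₂
    ∎
    where
    G₁ = kernelBlockProdFrom F₁ (f z ∷ seen₁) (map f (filterᵇ q zs))
    G₂ = kernelBlockProdFrom F₂ seen₂ (map f (filterᵇ (not ∘ q) zs))
    closed′ : ∀ {a b} → a ∈ zs → b ∈ zs → f a ≡ f b → q a ≡ q b
    closed′ a∈ b∈ = closed (there a∈) (there b∈)
    separated : ∀ {w} → w ∈ zs → T (not (q w)) → f w ≢ f z
    separated w∈ ¬qw e = T-not-elim ¬qw (≡true⇒T (trans (closed (there w∈) (here refl) e) qz))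
  ... | false = begin
      blockFactor F seen (f z) * kernelBlockProdFrom F (f z ∷ seen) (map f zs)
    ≈⟨ *-congˡ (kernelBlockProdFrom-split f q zs F F₁ F₂ (f z ∷ seen) seen₁ (f z ∷ seen₂) closed′
                 (λ w∈ qw → SameFactor-∷ˡ (separated w∈ qw) (same₁ (there w∈) qw))
                 (λ w∈ ¬qw → SameFactor-∷ (f z) (same₂ (there w∈) ¬qw))) ⟩
      blockFactor F seen (f z) * (G₁ * G₂)
    ≈⟨ x∙yz≈y∙xz _ _ _ ⟩
      G₁ * (blockFactor F seen (f z) * G₂)
    ≡⟨ cong (λ a → G₁ * (a * G₂)) (blockFactor-cong (same₂ (here refl) (subst (T ∘ not) (sym qz) tt))) ⟩
      G₁ * (blockFactor F₂ seen₂ (f z) * G₂)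
    ∎
    where
    G₁ = kernelBlockProdFrom F₁ seen₁ (map f (filterᵇ q zs))
    G₂ = kernelBlockProdFrom F₂ (f z ∷ seen₂) (map f (filterᵇ (not ∘ q) zs))
    closed′ : ∀ {a b} → a ∈ zs → b ∈ zs → f a ≡ f b → q a ≡ q b
    closed′ a∈ b∈ = closed (there a∈) (there b∈)
    separated : ∀ {w} → w ∈ zs → T (q w) → f w ≢ f z
    separated w∈ qw e = subst T (trans (closed (there w∈) (here refl) e) qz) qw

  kernelBlockProd-split : ∀ (f : ℕ → ℕ) (q : ℕ → Bool) zs →
    (∀ {a b} → a ∈ zs → b ∈ zs → f a ≡ f b → q a ≡ q b) →
    kernelBlockProd (map f zs) ≈ kernelBlockProd (map f (filterᵇ q zs)) * kernelBlockProd (map f (filterᵇ (not ∘ q) zs))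
  kernelBlockProd-split f q zs closed =
    kernelBlockProdFrom-split f q zs _ _ _ [] [] [] closed
      (λ {z} z∈ qz → sameFactor refl (sym (multiplicity-filterᵇ f q (f z) zs
                                            (λ a∈ e → subst T (sym (closed a∈ z∈ e)) qz))))
      (λ {z} z∈ ¬qz → sameFactor refl (sym (multiplicity-filterᵇ f (not ∘ q) (f z) zs
                                    (λ a∈ e → subst (T ∘ not) (sym (closed a∈ z∈ e)) ¬qz))))

  kernelBlockProd-replicate : ∀ {m} → 1 ≤ m → kernelBlockProd (replicate m 0) ≈ k m
  kernelBlockProd-replicate {suc m} _ =
    ≈-trans (*-congʳ (reflexive (cong (k ∘ suc) (multiplicity-replicate m))))
            (≈-trans (*-congˡ (rest≈1 [] m)) (*-identityʳ _))
    where
    rest≈1 : ∀ seen n → kernelBlockProdFrom (replicate (suc m) 0) (0 ∷ seen) (replicate n 0) ≈ 1#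
    rest≈1 seen zero    = ≈-refl
    rest≈1 seen (suc n) = ≈-trans (*-identityˡ _) (rest≈1 (0 ∷ seen) n)

-- Cuts

-- The lower-bound test local to gapsFrom, restated so that the gaps can be described.
above : Maybe ℕ → ℕ → Bool
above nothing  y = true
above (just x) y = x <ᵇ y

above-mono : ∀ lo {x z} → T (above lo x) → x < z → T (above lo z)
above-mono nothing  _ _ = tt
above-mono (just y) {x} t x<z = <⇒<ᵇ (<-trans (<ᵇ⇒< y x t) x<z)

gapsFrom-[] : ∀ n lo → gapsFrom n lo [] ≡ filterᵇ (above lo) (upTo n) ∷ []
gapsFrom-[] n nothing  = refl
gapsFrom-[] n (just z) = refl

gapsFrom-∷ : ∀ n lo x xs →
  gapsFrom n lo (x ∷ xs) ≡ filterᵇ (λ y → above lo y ∧ (y <ᵇ x)) (upTo n) ∷ gapsFrom n (just x) xs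
gapsFrom-∷ n nothing  x xs = refl
gapsFrom-∷ n (just z) x xs = refl

gapsFrom-filters : ∀ n lo xs → All (λ D → ∃ λ q → D ≡ filterᵇ q (upTo n)) (gapsFrom n lo xs)
gapsFrom-filters n lo []       rewrite gapsFrom-[] n lo = (above lo , refl) ∷ []
gapsFrom-filters n lo (x ∷ xs) rewrite gapsFrom-∷ n lo x xs = (_ , refl) ∷ gapsFrom-filters n (just x) xs

lowerPart-∷ : ∀ P S {x xs} → lowerElems P S ≡ x ∷ xs → lowerPart P S ≡ restrict P (x ∷ xs) ∷ []
lowerPart-∷ P S e with lowerElems P S
lowerPart-∷ P S refl | _ ∷ _ = refl

lowerPart-[] : ∀ P S → lowerElems P S ≡ [] → lowerPart P S ≡ []
lowerPart-[] P S e with lowerElems P S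
lowerPart-[] P S refl | [] = refl

lowerPart≡[]⇒lowerElems≡[] : ∀ P S → lowerPart P S ≡ [] → lowerElems P S ≡ []
lowerPart≡[]⇒lowerElems≡[] P S h with lowerElems P S
... | [] = refl

firstBlockCut : List ℕ → List Bool
firstBlockCut P = true ∷ replicate (pred (nBlocks P)) false

emptyCut : List ℕ → List Bool
emptyCut Q = replicate (nBlocks Q) false

atB-firstBlockCut : ∀ P j → atB (firstBlockCut P) j ≡ (j ≡ᵇ 0)
atB-firstBlockCut P zero    = refl
atB-firstBlockCut P (suc j) = atB-replicate-false (pred (nBlocks P)) j

record ArrowWitness (P : List ℕ) (π ρ : ℕ) : Set where
  constructor arrowWitness
  field
    {i a b} : ℕ
    ρ∋i     : at P i ≡ ρ
    π∋a     : at P a ≡ π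
    π∋b     : at P b ≡ π
    a≤i     : a ≤ i
    i≤b     : i ≤ b
    b<n     : b < length P

arrow⁻ : ∀ P {π ρ} → T (arrow P π ρ) → ArrowWitness P π ρ
arrow⁻ P {π} {ρ} t with T-any⁻ _ (upTo (length P)) t
... | i , _ , ti with T-any⁻ _ (upTo (length P)) (T-∧ʳ {at P i ≡ᵇ ρ} ti)
...   | a , _ , ta with T-any⁻ _ (upTo (length P)) ta
...     | b , b∈ , tb =
  arrowWitness (≡ᵇ⇒≡′ (T-∧ˡ ti)) (≡ᵇ⇒≡′ (T-∧ˡ tb)) (≡ᵇ⇒≡′ (T-∧ˡ tb₁))
               (≤ᵇ⇒≤ a i (T-∧ˡ tb₂)) (≤ᵇ⇒≤ i b (T-∧ʳ {a ≤ᵇ i} tb₂)) (∈-upTo⁻ b∈)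
  where
  tb₁ = T-∧ʳ {at P a ≡ᵇ π} tb
  tb₂ = T-∧ʳ {at P b ≡ᵇ π} tb₁

isLowerset⁺ : ∀ P S → (∀ π ρ → T (arrow P π ρ) → T (atB S ρ) → T (atB S π)) → T (isLowerset P S)
isLowerset⁺ P S closed =
  T-all⁺ _ bs λ {π} _ → T-all⁺ _ bs λ {ρ} _ → excluded {arrow P π ρ} {atB S ρ} {atB S π} (closed π ρ)
  where
  bs = upTo (nBlocks P)
  excluded : ∀ {u₁ u₂ u₃} → (T u₁ → T u₂ → T u₃) → T (not (u₁ ∧ u₂ ∧ not u₃))
  excluded {false} h = tt
  excluded {true} {false} h = tt
  excluded {true} {true} {false} h = h tt tt
  excluded {true} {true} {true} h = tt

_≟ᶜ_ : DecidableEquality (List Bool)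
_≟ᶜ_ = ≡-dec Bool._≟_

occurrences-subsets : ∀ S → occurrences _≟ᶜ_ S (subsets (length S)) ≡ 1
occurrences-subsets []      = refl
occurrences-subsets (b ∷ S) = trans (bothExtensions b (subsets (length S))) (occurrences-subsets S)
  where
  bothExtensions : ∀ b L → occurrences _≟ᶜ_ (b ∷ S) (concatMap (λ X → (false ∷ X) ∷ (true ∷ X) ∷ []) L)
                           ≡ occurrences _≟ᶜ_ S L
  bothExtensions b     []      = refl
  bothExtensions b (X ∷ L) = headOrNot b (S ≟ᶜ X)
    where
    rest = concatMap (λ X → (false ∷ X) ∷ (true ∷ X) ∷ []) L
    headOrNot : ∀ b → Dec (S ≡ X) → occurrences _≟ᶜ_ (b ∷ S) ((false ∷ X) ∷ (true ∷ X) ∷ rest)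
                                    ≡ occurrences _≟ᶜ_ S (X ∷ L)
    headOrNot false (yes refl) =
      trans (occurrences-≡ _≟ᶜ_ {false ∷ S} {false ∷ S} ((true ∷ S) ∷ rest) refl)
            (trans (cong suc (trans (occurrences-≢ _≟ᶜ_ {false ∷ S} {true ∷ S} rest (λ ())) (bothExtensions false L)))
                   (sym (occurrences-≡ _≟ᶜ_ L refl)))
    headOrNot true (yes refl) =
      trans (occurrences-≢ _≟ᶜ_ {true ∷ S} {false ∷ S} ((true ∷ S) ∷ rest) (λ ()))
            (trans (occurrences-≡ _≟ᶜ_ {true ∷ S} {true ∷ S} rest refl)
                   (trans (cong suc (bothExtensions true L)) (sym (occurrences-≡ _≟ᶜ_ L refl))))
    headOrNot b (no S≢X) =
      trans (occurrences-≢ _≟ᶜ_ {b ∷ S} {false ∷ X} ((true ∷ X) ∷ rest) (S≢X ∘ ∷-injectiveʳ))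
            (trans (occurrences-≢ _≟ᶜ_ {b ∷ S} {true ∷ X} rest (S≢X ∘ ∷-injectiveʳ))
                   (trans (bothExtensions b L) (sym (occurrences-≢ _≟ᶜ_ L S≢X))))

∈-subsets⇒length : ∀ m {S} → S ∈ subsets m → length S ≡ m
∈-subsets⇒length zero    (here refl) = refl
∈-subsets⇒length (suc m) S∈ with find (∈-concatMap⁻ (λ X → (false ∷ X) ∷ (true ∷ X) ∷ []) {xs = subsets m} S∈)
... | X , X∈ , here refl         = cong suc (∈-subsets⇒length m X∈)
... | X , X∈ , there (here refl) = cong suc (∈-subsets⇒length m X∈)

_≟ʷ_ : DecidableEquality (List (List Bool))
_≟ʷ_ = ≡-dec _≟ᶜ_

IsCutOf : List ℕ → List Bool → Set
IsCutOf Q S = T (isLowerset Q S) × length S ≡ nBlocks Q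

∈-cutsOf⇒length : ∀ Q {S} → S ∈ cutsOf Q → length S ≡ nBlocks Q
∈-cutsOf⇒length Q S∈ =
  ∈-subsets⇒length (nBlocks Q) (proj₁ (∈-filter⁻ (T? ∘ isLowerset Q) {xs = subsets (nBlocks Q)} S∈))

occurrences-cutsOf : ∀ Q S → IsCutOf Q S → occurrences _≟ᶜ_ S (cutsOf Q) ≡ 1
occurrences-cutsOf Q S (S-lowerset , length-S) =
  trans (occurrences-filterᵇ _≟ᶜ_ (isLowerset Q) S (subsets (nBlocks Q)) S-lowerset)
        (trans (cong (λ m → occurrences _≟ᶜ_ S (subsets m)) (sym length-S)) (occurrences-subsets S))

∈-wordCuts⁻ : ∀ Q w {cs} → cs ∈ wordCuts (Q ∷ w) →
  ∃ λ S → ∃ λ cs′ → cs ≡ S ∷ cs′ × S ∈ cutsOf Q × cs′ ∈ wordCuts w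
∈-wordCuts⁻ Q w cs∈ with find (∈-concatMap⁻ (λ S → map (S ∷_) (wordCuts w)) {xs = cutsOf Q} cs∈)
... | S , S∈ , cs∈′ with ∈-map⁻ (S ∷_) cs∈′
...   | cs′ , cs′∈ , refl = S , cs′ , refl , S∈ , cs′∈

occurrences-wordCuts : ∀ {w cs} → Pointwise IsCutOf w cs → occurrences _≟ʷ_ cs (wordCuts w) ≡ 1
occurrences-wordCuts []                          = refl
occurrences-wordCuts {Q ∷ w} {S ∷ cs} (S-cut ∷ cs-cuts) =
  trans (occurrences-concatMap-∷ _≟ᶜ_ S cs (wordCuts w) (cutsOf Q))
        (cong₂ ℕ._*_ (occurrences-cutsOf Q S S-cut) (occurrences-wordCuts cs-cuts))

emptyCut-isCut : ∀ Q → IsCutOf Q (emptyCut Q)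
emptyCut-isCut Q =
  isLowerset⁺ Q (emptyCut Q) (λ π ρ _ ρ∈ → ⊥-elim (subst T (atB-replicate-false (nBlocks Q) ρ) ρ∈)) ,
  length-replicate (nBlocks Q)

lowerElems-emptyCut : ∀ Q → lowerElems Q (emptyCut Q) ≡ []
lowerElems-emptyCut Q =
  filter-none (T? ∘ (λ i → atB (emptyCut Q) (at Q i))) {xs = upTo (length Q)}
    (All.tabulate (λ {i} _ → subst T (atB-replicate-false (nBlocks Q) (at Q i))))

gapMonomial-emptyCut : ∀ Q → IsNCP Q → gapMonomial Q (emptyCut Q) ≡ Q ∷ []
gapMonomial-emptyCut Q Q-ncp = begin
  gapMonomial Q (emptyCut Q)
    ≡⟨ cong (λ X → map (restrict Q) (filterᵇ nonEmpty (gapsFrom n nothing X))) (lowerElems-emptyCut Q) ⟩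
  map (restrict Q) (filterᵇ nonEmpty (gapsFrom n nothing []))
    ≡⟨ cong (map (restrict Q) ∘ filterᵇ nonEmpty) (trans (gapsFrom-[] n nothing) (cong (_∷ []) (filterᵇ-true (upTo n)))) ⟩
  map (restrict Q) (filterᵇ nonEmpty (upTo n ∷ []))
    ≡⟨ cong (map (restrict Q)) (filter-accept (T? ∘ nonEmpty) (nonEmpty-upTo (isNCP⇒0<length Q Q-ncp))) ⟩
  standardizeWith [] (map (at Q) (upTo n)) ∷ []
    ≡⟨ cong (λ X → standardizeWith [] X ∷ []) (map-at-upTo Q) ⟩
  standardizeWith [] Q ∷ []
    ≡⟨ cong (_∷ []) (standardize-rgs Q (isNCP⇒isRGS Q Q-ncp)) ⟩
  Q ∷ []
    ∎
  where
  open ≡-Reasoning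
  n = length Q
  nonEmpty-upTo : ∀ {m} → 0 < m → T (nonEmpty (upTo m))
  nonEmpty-upTo {suc m} _ = tt
  filterᵇ-true : ∀ xs → filterᵇ (λ _ → true) xs ≡ xs
  filterᵇ-true []       = refl
  filterᵇ-true (x ∷ xs) = cong (x ∷_) (filterᵇ-true xs)

All⇒validWord : ∀ w → All IsNCP w → ValidWord w
All⇒validWord w w-ncp = T-all⁺ isNCP w (All.lookup w-ncp)

lowerElems≡[]⇒emptyCut : ∀ Q S → IsNCP Q → S ∈ cutsOf Q → lowerElems Q S ≡ [] → S ≡ emptyCut Q
lowerElems≡[]⇒emptyCut Q S Q-ncp S∈ noElems = allFalse S (nBlocks Q) (∈-cutsOf⇒length Q S∈) blockAbsent
  where
  blockAbsent : ∀ j → j < nBlocks Q → atB S j ≡ false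
  blockAbsent j j<nQ with atB S j in S∋j
  ... | false = refl
  ... | true with rgs-label-occurs Q (isNCP⇒isRGS Q Q-ncp) j<nQ
  ...   | i , i<n , refl with subst (i ∈_) noElems
                                (∈-filter⁺ (T? ∘ (λ i → atB S (at Q i))) (∈-upTo⁺ i<n) (≡true⇒T S∋j))
  ...     | ()
  allFalse : ∀ S r → length S ≡ r → (∀ j → j < r → atB S j ≡ false) → S ≡ replicate r false
  allFalse []      zero    _ _ = refl
  allFalse (b ∷ S) (suc r) e h =
    cong₂ _∷_ (h 0 (s≤s z≤n)) (allFalse S r (ℕₚ.suc-injective e) (λ j l → h (suc j) (s≤s l)))

cutLeft≡[]⇒emptyCuts : ∀ w cs → All IsNCP w → cs ∈ wordCuts w → cutLeft w cs ≡ [] → cs ≡ map emptyCut w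
cutLeft≡[]⇒emptyCuts []      cs      _                 (here refl) _ = refl
cutLeft≡[]⇒emptyCuts (Q ∷ w) cs      (Q-ncp ∷ w-ncp)   cs∈         noLeft with ∈-wordCuts⁻ Q w cs∈
... | S , cs′ , refl , S∈ , cs′∈ =
  cong₂ _∷_ (lowerElems≡[]⇒emptyCut Q S Q-ncp S∈ (lowerPart≡[]⇒lowerElems≡[] Q S (++-conicalˡ (lowerPart Q S) _ noLeft)))
            (cutLeft≡[]⇒emptyCuts w cs′ w-ncp cs′∈ (++-conicalʳ (lowerPart Q S) _ noLeft))

lowerPart-isNCP : ∀ Q S → IsNCP Q → All IsNCP (lowerPart Q S)
lowerPart-isNCP Q S Q-ncp with lowerElems Q S in X≡
... | []     = []
... | x ∷ xs = subst (IsNCP ∘ restrict Q) X≡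
                 (restrict-filterᵇ-isNCP Q Q-ncp (λ i → atB S (at Q i)) (λ X≡[] → case trans (sym X≡) X≡[] of λ ()))
               ∷ []

cutLeft-isNCP : ∀ w cs → All IsNCP w → All IsNCP (cutLeft w cs)
cutLeft-isNCP []      cs       _               = []
cutLeft-isNCP (Q ∷ w) []       _               = []
cutLeft-isNCP (Q ∷ w) (S ∷ cs) (Q-ncp ∷ w-ncp) = AllP.++⁺ (lowerPart-isNCP Q S Q-ncp) (cutLeft-isNCP w cs w-ncp)

cutLeft-emptyCuts : ∀ w → cutLeft w (map emptyCut w) ≡ []
cutLeft-emptyCuts []      = refl
cutLeft-emptyCuts (Q ∷ w) = cong₂ _++_ (lowerPart-[] Q (emptyCut Q) (lowerElems-emptyCut Q)) (cutLeft-emptyCuts w)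

cutRight-emptyCuts : ∀ w → All IsNCP w → cutRight w (map emptyCut w) ≡ w
cutRight-emptyCuts []      []              = refl
cutRight-emptyCuts (Q ∷ w) (Q-ncp ∷ w-ncp) = cong₂ _++_ (gapMonomial-emptyCut Q Q-ncp) (cutRight-emptyCuts w w-ncp)

restrict≡I⇒sameLabel : ∀ P X m {a b} → restrict P X ≡ I m → a ∈ X → b ∈ X → at P a ≡ at P b
restrict≡I⇒sameLabel P X m {a} {b} R≡I a∈ b∈ with ∈⇒at X a∈ | ∈⇒at X b∈
... | s , s<n , refl | t , t<n , refl =
  restrict-reflects-≡ P X s<n t<n
    (subst (λ L → at L s ≡ at L t) (sym R≡I) (trans (at-replicate-0 m s) (sym (at-replicate-0 m t))))

0∈lowerElems : ∀ P S → IsNCP P → T (atB S 0) → 0 ∈ lowerElems P S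
0∈lowerElems P S P-ncp S∋0 =
  ∈-filter⁺ (T? ∘ (λ i → atB S (at P i))) (∈-upTo⁺ (isNCP⇒0<length P P-ncp))
            (subst (T ∘ atB S) (sym (isNCP⇒at0≡0 P P-ncp)) S∋0)

≢replicate-false⇒atB-true : ∀ S → S ≢ replicate (length S) false → ∃ λ t → t < length S × atB S t ≡ true
≢replicate-false⇒atB-true []          S≢ = ⊥-elim (S≢ refl)
≢replicate-false⇒atB-true (true ∷ S)  _  = 0 , s≤s z≤n , refl
≢replicate-false⇒atB-true (false ∷ S) S≢ with ≢replicate-false⇒atB-true S (S≢ ∘ cong (false ∷_))
... | t , t<n , S∋t = suc t , s≤s t<n , S∋t

otherBlock-∈-lowerElems : ∀ P S → IsNCP P → length S ≡ nBlocks P → T (atB S 0) → S ≢ firstBlockCut P →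
  ∃ λ i → i ∈ lowerElems P S × at P i ≢ 0
otherBlock-∈-lowerElems P (true ∷ S′) P-ncp length-S _ S≢first
  with ≢replicate-false⇒atB-true S′
         (λ S′≡ → S≢first (cong (true ∷_) (trans S′≡ (cong (λ m → replicate m false) (cong pred length-S)))))
... | t , t<n , S′∋t with rgs-label-occurs P (isNCP⇒isRGS P P-ncp) (subst (suc t <_) length-S (s≤s t<n))
...   | i , i<n , i∈t =
  i , ∈-filter⁺ (T? ∘ (λ i → atB (true ∷ S′) (at P i))) (∈-upTo⁺ i<n)
                (subst (T ∘ atB (true ∷ S′)) (sym i∈t) (≡true⇒T S′∋t)) ,
  (λ i∈0 → case trans (sym i∈t) i∈0 of λ ())

restrict-lowerElems≢I : ∀ P S → IsNCP P → length S ≡ nBlocks P → T (atB S 0) → S ≢ firstBlockCut P →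
  ∀ m → restrict P (lowerElems P S) ≢ I m
restrict-lowerElems≢I P S P-ncp length-S S∋0 S≢first m R≡I
  with otherBlock-∈-lowerElems P S P-ncp length-S S∋0 S≢first
... | i , i∈ , i∉0 =
  i∉0 (trans (sym (restrict≡I⇒sameLabel P (lowerElems P S) m R≡I (0∈lowerElems P S P-ncp S∋0) i∈)) (isNCP⇒at0≡0 P P-ncp))

-- The block of 1

wordSize : Word → ℕ
wordSize w = sum (map length w)

wordSize-++ : ∀ v w → wordSize (v ++ w) ≡ wordSize v ℕ.+ wordSize w
wordSize-++ v w = trans (cong sum (map-++ length v w)) (sum-++ (map length v) (map length w))

module FirstBlock (P : List ℕ) (P-ncp : IsNCP P) where

  n : ℕ
  n = length P

  inFirst : ℕ → Bool
  inFirst i = at P i ≡ᵇ 0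

  firstBlock : List ℕ
  firstBlock = filterᵇ inFirst (upTo n)

  outsideAbove : Maybe ℕ → List ℕ
  outsideAbove lo = filterᵇ (λ i → not (inFirst i) ∧ above lo i) (upTo n)

  inFirst-0 : T (inFirst 0)
  inFirst-0 = ≡⇒≡ᵇ′ (isNCP⇒at0≡0 P P-ncp)

  outside⇒0< : ∀ {i} → T (not (inFirst i)) → 0 < i
  outside⇒0< {zero}  i∉ = ⊥-elim (T-not-elim i∉ inFirst-0)
  outside⇒0< {suc i} _  = s≤s z≤n

  -- The block of 1 contains 0 and x, so a block with points on both sides of x would cross it.
  firstBlock-separates : ∀ {x a b} → b < n → T (inFirst x) → T (not (inFirst a)) → a < x → x < b → at P a ≢ at P b
  firstBlock-separates b<n x₁ a∉ a<x x<b e =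
    T-not-elim a∉ (≡⇒≡ᵇ′ (trans (sym at0≡ata) (isNCP⇒at0≡0 P P-ncp)))
    where
    at0≡ata = isNCP⇒NonCrossing P P-ncp (outside⇒0< a∉) a<x x<b b<n
                (trans (isNCP⇒at0≡0 P P-ncp) (sym (≡ᵇ⇒≡′ x₁))) e

  outsideAbove⁻ : ∀ lo {z} → z ∈ outsideAbove lo → z < n × T (not (inFirst z)) × T (above lo z)
  outsideAbove⁻ lo z∈ with ∈-filter⁻ (T? ∘ (λ i → not (inFirst i) ∧ above lo i)) {xs = upTo n} z∈
  ... | z∈ns , t = ∈-upTo⁻ z∈ns , T-∧ˡ t , T-∧ʳ {not (inFirst _)} t

  outside-≮⇒> : ∀ {x y} → T (inFirst x) → T (not (inFirst y)) → (y <ᵇ x) ≡ false → x < y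
  outside-≮⇒> {x} {y} x₁ y∉ y≮x =
    ≤∧≢⇒< (≮⇒≥ (λ y<x → subst T y≮x (<⇒<ᵇ y<x))) (λ { refl → T-not-elim y∉ x₁ })

  outsideAbove-sameSide : ∀ lo {x a b} → T (inFirst x) → a ∈ outsideAbove lo → b ∈ outsideAbove lo →
    at P a ≡ at P b → (a <ᵇ x) ≡ (b <ᵇ x)
  outsideAbove-sameSide lo {x} {a} {b} x₁ a∈ b∈ e
    with outsideAbove⁻ lo a∈ | outsideAbove⁻ lo b∈ | a <ᵇ x in ax | b <ᵇ x in bx
  ... | _ | _ | true  | true  = refl
  ... | _ | _ | false | false = refl
  ... | _ , a∉ , _ | b<n , b∉ , _ | true | false =
    ⊥-elim (firstBlock-separates b<n x₁ a∉ (<ᵇ⇒< a x (≡true⇒T ax)) (outside-≮⇒> x₁ b∉ bx) e)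
  ... | a<n , a∉ , _ | _ , b∉ , _ | false | true =
    ⊥-elim (firstBlock-separates a<n x₁ b∉ (<ᵇ⇒< b x (≡true⇒T bx)) (outside-≮⇒> x₁ a∉ ax) (sym e))

  Enumerates : Maybe ℕ → List ℕ → Set
  Enumerates lo xs = (∀ {z} → z ∈ xs → z < n × T (inFirst z) × T (above lo z))
                   × (∀ {z} → z < n → T (inFirst z) → T (above lo z) → z ∈ xs)

  module _ (lo : Maybe ℕ) where

    outsideAbove-[] : Enumerates lo [] → outsideAbove lo ≡ filterᵇ (above lo) (upTo n)
    outsideAbove-[] (_ , complete) = filterᵇ-cong (upTo n) outsideIsAbove
      where
      outsideIsAbove : ∀ {i} → i ∈ upTo n → (not (inFirst i) ∧ above lo i) ≡ above lo i
      outsideIsAbove {i} i∈ with inFirst i in i₁ | above lo i in i↑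
      ... | false | _     = refl
      ... | true  | false = refl
      ... | true  | true  with complete (∈-upTo⁻ i∈) (≡true⇒T i₁) (≡true⇒T i↑)
      ...   | ()

    module _ {x xs} (incr : Increasing (x ∷ xs)) (enum : Enumerates lo (x ∷ xs)) where

      private
        x<n = proj₁ (proj₁ enum (here refl))
        x₁  = proj₁ (proj₂ (proj₁ enum (here refl)))
        x↑  = proj₂ (proj₂ (proj₁ enum (here refl)))

      -- Every point of the block of 1 strictly between lo and x would be in xs, hence above x.
      outsideAbove-below : filterᵇ (_<ᵇ x) (outsideAbove lo) ≡ filterᵇ (λ y → above lo y ∧ (y <ᵇ x)) (upTo n)
      outsideAbove-below = trans (filterᵇ-filterᵇ _ (_<ᵇ x) (upTo n)) (filterᵇ-cong (upTo n) gapIsOutside)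
        where
        gapIsOutside : ∀ {i} → i ∈ upTo n → ((not (inFirst i) ∧ above lo i) ∧ (i <ᵇ x)) ≡ (above lo i ∧ (i <ᵇ x))
        gapIsOutside {i} i∈ with inFirst i in i₁ | above lo i in i↑ | i <ᵇ x in i<x
        ... | false | _     | _     = refl
        ... | true  | false | _     = refl
        ... | true  | true  | false = refl
        ... | true  | true  | true  with proj₂ enum (∈-upTo⁻ i∈) (≡true⇒T i₁) (≡true⇒T i↑)
        ...   | here refl = ⊥-elim (<-irrefl refl (<ᵇ⇒< i i (≡true⇒T i<x)))
        ...   | there i∈xs = ⊥-elim (<-asym (All.lookup (AllPairs.head incr) i∈xs) (<ᵇ⇒< i x (≡true⇒T i<x)))

      outsideAbove-notBelow : filterᵇ (not ∘ (_<ᵇ x)) (outsideAbove lo) ≡ outsideAbove (just x)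
      outsideAbove-notBelow = trans (filterᵇ-filterᵇ _ (not ∘ (_<ᵇ x)) (upTo n)) (filterᵇ-cong (upTo n) notBelow⇔above)
        where
        notBelow⇔above : ∀ {i} → i ∈ upTo n →
          ((not (inFirst i) ∧ above lo i) ∧ not (i <ᵇ x)) ≡ (not (inFirst i) ∧ (x <ᵇ i))
        notBelow⇔above {i} _ with inFirst i in i₁
        ... | true  = refl
        ... | false with <-cmp i x
        ...   | tri< i<x _ _ rewrite T⇒≡true (<⇒<ᵇ i<x) | ≮⇒<ᵇ≡false (<⇒≯ i<x) = ∧-zeroʳ (above lo i)
        ...   | tri≈ _ refl _ = ⊥-elim (subst T i₁ x₁)
        ...   | tri> _ _ x<i
          rewrite T⇒≡true (above-mono lo x↑ x<i) | T⇒≡true (<⇒<ᵇ x<i) | ≮⇒<ᵇ≡false (<⇒≯ x<i) = refl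

      Enumerates-tail : Enumerates (just x) xs
      Enumerates-tail = sound , complete
        where
        sound : ∀ {z} → z ∈ xs → z < n × T (inFirst z) × T (x <ᵇ z)
        sound z∈ = proj₁ (proj₁ enum (there z∈)) , proj₁ (proj₂ (proj₁ enum (there z∈)))
                 , <⇒<ᵇ (All.lookup (AllPairs.head incr) z∈)
        complete : ∀ {z} → z < n → T (inFirst z) → T (x <ᵇ z) → z ∈ xs
        complete {z} z<n z₁ x<z with proj₂ enum z<n z₁ (above-mono lo x↑ (<ᵇ⇒< x z x<z))
        ... | here refl = ⊥-elim (<-irrefl refl (<ᵇ⇒< x x x<z))
        ... | there z∈xs = z∈xs

  length-outsideAbove : ∀ lo xs → Increasing xs → Enumerates lo xs → length (outsideAbove lo) ≡ wordSize (gapsFrom n lo xs)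
  length-outsideAbove lo [] _ enum = begin
    length (outsideAbove lo)                     ≡⟨ cong length (outsideAbove-[] lo enum) ⟩
    length (filterᵇ (above lo) (upTo n))         ≡⟨ sym (ℕₚ.+-identityʳ _) ⟩
    wordSize (filterᵇ (above lo) (upTo n) ∷ [])  ≡⟨ cong wordSize (sym (gapsFrom-[] n lo)) ⟩
    wordSize (gapsFrom n lo [])                  ∎
    where open ≡-Reasoning
  length-outsideAbove lo (x ∷ xs) incr enum = begin
    length (outsideAbove lo)
      ≡⟨ length-filterᵇ (_<ᵇ x) (outsideAbove lo) ⟩
    length (filterᵇ (_<ᵇ x) (outsideAbove lo)) ℕ.+ length (filterᵇ (not ∘ (_<ᵇ x)) (outsideAbove lo))
      ≡⟨ cong₂ ℕ._+_ (cong length (outsideAbove-below lo incr enum)) (cong length (outsideAbove-notBelow lo incr enum)) ⟩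
    length (filterᵇ (λ y → above lo y ∧ (y <ᵇ x)) (upTo n)) ℕ.+ length (outsideAbove (just x))
      ≡⟨ cong (length (filterᵇ (λ y → above lo y ∧ (y <ᵇ x)) (upTo n)) ℕ.+_)
              (length-outsideAbove (just x) xs (AllPairs.tail incr) (Enumerates-tail lo incr enum)) ⟩
    wordSize (filterᵇ (λ y → above lo y ∧ (y <ᵇ x)) (upTo n) ∷ gapsFrom n (just x) xs)
      ≡⟨ cong wordSize (sym (gapsFrom-∷ n lo x xs)) ⟩
    wordSize (gapsFrom n lo (x ∷ xs))
      ∎
    where open ≡-Reasoning

  firstBlock-∷ : ∃ λ rest → firstBlock ≡ 0 ∷ rest
  firstBlock-∷ = starts n (isNCP⇒0<length P P-ncp)
    where
    starts : ∀ m → 0 < m → ∃ λ rest → filterᵇ inFirst (upTo m) ≡ 0 ∷ rest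
    starts (suc m) _ with inFirst 0 in e
    ... | true  = _ , refl
    ... | false = ⊥-elim (subst T e inFirst-0)

  firstBlockSize : ℕ
  firstBlockSize = length firstBlock

  1≤firstBlockSize : 1 ≤ firstBlockSize
  1≤firstBlockSize = subst (λ B → 1 ≤ length B) (sym (proj₂ firstBlock-∷)) (s≤s z≤n)

  firstBlock-increasing : Increasing firstBlock
  firstBlock-increasing = AllPairsₚ.filter⁺ (T? ∘ inFirst) (upTo-increasing n)

  firstBlock-Enumerates : Enumerates nothing firstBlock
  firstBlock-Enumerates =
    (λ z∈ → let z∈ns , z₁ = ∈-filter⁻ (T? ∘ inFirst) {xs = upTo n} z∈ in ∈-upTo⁻ z∈ns , z₁ , tt) ,
    (λ z<n z₁ _ → ∈-filter⁺ (T? ∘ inFirst) (∈-upTo⁺ z<n) z₁)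

  outsideAbove-nothing : filterᵇ (not ∘ inFirst) (upTo n) ≡ outsideAbove nothing
  outsideAbove-nothing = filterᵇ-cong (upTo n) (λ {i} _ → sym (∧-identityʳ (not (inFirst i))))

  lowerElems-firstBlockCut : lowerElems P (firstBlockCut P) ≡ firstBlock
  lowerElems-firstBlockCut = filterᵇ-cong (upTo n) (λ {i} _ → atB-firstBlockCut P (at P i))

  firstBlock-labels : map (at P) firstBlock ≡ replicate firstBlockSize 0
  firstBlock-labels = all-0 firstBlock (λ z∈ → ≡ᵇ⇒≡′ (proj₂ (∈-filter⁻ (T? ∘ inFirst) {xs = upTo n} z∈)))
    where
    all-0 : ∀ xs → (∀ {x} → x ∈ xs → at P x ≡ 0) → map (at P) xs ≡ replicate (length xs) 0
    all-0 []       h = refl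
    all-0 (x ∷ xs) h = cong₂ _∷_ (h (here refl)) (all-0 xs (h ∘ there))

  lowerPart-firstBlockCut : lowerPart P (firstBlockCut P) ≡ I firstBlockSize ∷ []
  lowerPart-firstBlockCut =
    trans (lowerPart-∷ P (firstBlockCut P) (trans lowerElems-firstBlockCut (proj₂ firstBlock-∷)))
          (cong (_∷ []) (begin
            restrict P (0 ∷ proj₁ firstBlock-∷)               ≡⟨ cong (restrict P) (sym (proj₂ firstBlock-∷)) ⟩
            standardizeWith [] (map (at P) firstBlock)         ≡⟨ cong (standardizeWith []) firstBlock-labels ⟩
            standardizeWith [] (replicate firstBlockSize 0)    ≡⟨ standardize-replicate-0 firstBlockSize ⟩
            I firstBlockSize                                   ∎))
    where open ≡-Reasoning

  firstGaps : List (List ℕ)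
  firstGaps = gapsFrom n nothing firstBlock

  gapMonomial-firstBlockCut : gapMonomial P (firstBlockCut P) ≡ map (restrict P) (filterᵇ nonEmpty firstGaps)
  gapMonomial-firstBlockCut = cong (λ X → map (restrict P) (filterᵇ nonEmpty (gapsFrom n nothing X))) lowerElems-firstBlockCut

  firstBlockSize+wordSize-gapMonomial : firstBlockSize ℕ.+ wordSize (gapMonomial P (firstBlockCut P)) ≡ n
  firstBlockSize+wordSize-gapMonomial = begin
    firstBlockSize ℕ.+ wordSize (gapMonomial P (firstBlockCut P))
      ≡⟨ cong (firstBlockSize ℕ.+_) (trans (cong wordSize gapMonomial-firstBlockCut) (wordSize-restrict firstGaps)) ⟩
    firstBlockSize ℕ.+ wordSize firstGaps
      ≡⟨ cong (firstBlockSize ℕ.+_) (sym (length-outsideAbove nothing firstBlock firstBlock-increasing firstBlock-Enumerates)) ⟩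
    firstBlockSize ℕ.+ length (outsideAbove nothing)
      ≡⟨ cong (λ Y → firstBlockSize ℕ.+ length Y) (sym outsideAbove-nothing) ⟩
    firstBlockSize ℕ.+ length (filterᵇ (not ∘ inFirst) (upTo n))
      ≡⟨ sym (length-filterᵇ inFirst (upTo n)) ⟩
    length (upTo n)
      ≡⟨ length-upTo n ⟩
    n ∎
    where
    open ≡-Reasoning
    wordSize-restrict : ∀ gs → wordSize (map (restrict P) (filterᵇ nonEmpty gs)) ≡ wordSize gs
    wordSize-restrict []             = refl
    wordSize-restrict ([] ∷ gs)      = wordSize-restrict gs
    wordSize-restrict ((x ∷ D) ∷ gs) = cong₂ ℕ._+_ (length-restrict P (x ∷ D)) (wordSize-restrict gs)

  wordSize-gapMonomial<n : wordSize (gapMonomial P (firstBlockCut P)) < n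
  wordSize-gapMonomial<n =
    subst (wordSize (gapMonomial P (firstBlockCut P)) <_) firstBlockSize+wordSize-gapMonomial
          (m<n+m (wordSize (gapMonomial P (firstBlockCut P))) 1≤firstBlockSize)

  gapMonomial-firstBlockCut-isNCP : All IsNCP (gapMonomial P (firstBlockCut P))
  gapMonomial-firstBlockCut-isNCP =
    subst (All IsNCP) (sym gapMonomial-firstBlockCut) (restrictAll firstGaps (gapsFrom-filters n nothing firstBlock))
    where
    restrictAll : ∀ gs → All (λ D → ∃ λ q → D ≡ filterᵇ q (upTo n)) gs →
      All IsNCP (map (restrict P) (filterᵇ nonEmpty gs))
    restrictAll []             []                = []
    restrictAll ([] ∷ gs)      (_ ∷ gs-filters)  = restrictAll gs gs-filters
    restrictAll ((x ∷ D) ∷ gs) ((q , e) ∷ gs-filters) =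
      subst (IsNCP ∘ restrict P) (sym e) (restrict-filterᵇ-isNCP P P-ncp q (λ e′ → case trans e e′ of λ ()))
      ∷ restrictAll gs gs-filters

  length-firstBlockCut : length (firstBlockCut P) ≡ nBlocks P
  length-firstBlockCut = trans (cong suc (length-replicate (pred (nBlocks P))))
                               (suc-pred (nBlocks P) (at<nBlocks P (isNCP⇒0<length P P-ncp)))
    where
    suc-pred : ∀ m {a} → a < m → suc (pred m) ≡ m
    suc-pred (suc m) _ = refl

  firstBlockCut-isLowerset : T (isLowerset P (firstBlockCut P))
  firstBlockCut-isLowerset = isLowerset⁺ P (firstBlockCut P) λ π ρ π→ρ ρ∈ →
    subst T (sym (atB-firstBlockCut P π)) (closed π ρ (arrow⁻ P π→ρ) (subst T (atB-firstBlockCut P ρ) ρ∈))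
    where
    closed : ∀ π ρ → ArrowWitness P π ρ → T (ρ ≡ᵇ 0) → T (π ≡ᵇ 0)
    closed π ρ (arrowWitness {i} {a} {b} ρ∋i π∋a π∋b a≤i i≤b b<n) ρ≡0 with π ℕ.≟ 0
    ... | yes π≡0 = ≡⇒≡ᵇ′ π≡0
    ... | no  π≢0 = ⊥-elim (firstBlock-separates b<n i₁ a∉ a<i i<b (trans π∋a (sym π∋b)))
      where
      at-i≡0 : at P i ≡ 0
      at-i≡0 = trans ρ∋i (≡ᵇ⇒≡′ ρ≡0)
      i₁ : T (inFirst i)
      i₁ = ≡⇒≡ᵇ′ at-i≡0
      a∉ : T (not (inFirst a))
      a∉ = subst (T ∘ not) (sym (≢⇒≡ᵇ≡false (π≢0 ∘ trans (sym π∋a)))) tt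
      a<i : a < i
      a<i = ≤∧≢⇒< a≤i (λ a≡i → π≢0 (trans (sym π∋a) (trans (cong (at P) a≡i) at-i≡0)))
      i<b : i < b
      i<b = ≤∧≢⇒< i≤b (λ i≡b → π≢0 (trans (sym π∋b) (trans (cong (at P) (sym i≡b)) at-i≡0)))

module FirstBlockProduct {c ℓ} (R : CommutativeRing c ℓ) (k : ℕ → CommutativeRing.Carrier R)
                         (P : List ℕ) (P-ncp : IsNCP P) where
  open CommutativeRing R renaming (refl to ≈-refl; sym to ≈-sym; trans to ≈-trans)
  open RingSums R
  open KernelBlockProduct R k
  open FirstBlock P P-ncp
  open import Relation.Binary.Reasoning.Setoid setoid

  gapProduct : List (List ℕ) → Carrier
  gapProduct gs = prodR R (map (λ D → kernelBlockProd (map (at P) D)) gs)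

  kernelBlockProd-outsideAbove : ∀ lo xs → Increasing xs → Enumerates lo xs →
    kernelBlockProd (map (at P) (outsideAbove lo)) ≈ gapProduct (gapsFrom n lo xs)
  kernelBlockProd-outsideAbove lo [] _ enum = begin
    kernelBlockProd (map (at P) (outsideAbove lo))                  ≡⟨ cong (kernelBlockProd ∘ map (at P)) (outsideAbove-[] lo enum) ⟩
    kernelBlockProd (map (at P) (filterᵇ (above lo) (upTo n)))      ≈⟨ ≈-sym (*-identityʳ _) ⟩
    gapProduct (filterᵇ (above lo) (upTo n) ∷ [])                   ≡⟨ cong gapProduct (sym (gapsFrom-[] n lo)) ⟩
    gapProduct (gapsFrom n lo [])                                   ∎
  kernelBlockProd-outsideAbove lo (x ∷ xs) incr enum = begin
    kernelBlockProd (map (at P) (outsideAbove lo))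
      ≈⟨ kernelBlockProd-split (at P) (_<ᵇ x) (outsideAbove lo) (outsideAbove-sameSide lo x₁) ⟩
    kernelBlockProd (map (at P) (filterᵇ (_<ᵇ x) (outsideAbove lo)))
      * kernelBlockProd (map (at P) (filterᵇ (not ∘ (_<ᵇ x)) (outsideAbove lo)))
      ≡⟨ cong₂ (λ below notBelow → kernelBlockProd (map (at P) below) * kernelBlockProd (map (at P) notBelow))
               (outsideAbove-below lo incr enum) (outsideAbove-notBelow lo incr enum) ⟩
    kernelBlockProd (map (at P) (filterᵇ (λ y → above lo y ∧ (y <ᵇ x)) (upTo n)))
      * kernelBlockProd (map (at P) (outsideAbove (just x)))
      ≈⟨ *-congˡ (kernelBlockProd-outsideAbove (just x) xs (AllPairs.tail incr) (Enumerates-tail lo incr enum)) ⟩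
    gapProduct (filterᵇ (λ y → above lo y ∧ (y <ᵇ x)) (upTo n) ∷ gapsFrom n (just x) xs)
      ≡⟨ cong gapProduct (sym (gapsFrom-∷ n lo x xs)) ⟩
    gapProduct (gapsFrom n lo (x ∷ xs))
      ∎
    where
    x₁ = proj₁ (proj₂ (proj₁ enum (here refl)))

  blockProd-decomposition :
    blockProd R k P ≈ k firstBlockSize * prodR R (map (blockProd R k) (gapMonomial P (firstBlockCut P)))
  blockProd-decomposition = begin
    blockProd R k P
      ≈⟨ blockProd≈kernelBlockProd P (isNCP⇒isRGS P P-ncp) ⟩
    kernelBlockProd P
      ≡⟨ cong kernelBlockProd (sym (map-at-upTo P)) ⟩
    kernelBlockProd (map (at P) (upTo n))
      ≈⟨ kernelBlockProd-split (at P) inFirst (upTo n) (λ _ _ e → cong (_≡ᵇ 0) e) ⟩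
    kernelBlockProd (map (at P) firstBlock) * kernelBlockProd (map (at P) (filterᵇ (not ∘ inFirst) (upTo n)))
      ≈⟨ *-cong firstFactor (≈-trans (reflexive (cong (kernelBlockProd ∘ map (at P)) outsideAbove-nothing))
                                     (kernelBlockProd-outsideAbove nothing firstBlock firstBlock-increasing firstBlock-Enumerates)) ⟩
    k firstBlockSize * gapProduct firstGaps
      ≈⟨ *-congˡ (≈-sym (restrictedGaps firstGaps)) ⟩
    k firstBlockSize * prodR R (map (blockProd R k) (map (restrict P) (filterᵇ nonEmpty firstGaps)))
      ≡⟨ cong (λ w → k firstBlockSize * prodR R (map (blockProd R k) w)) (sym gapMonomial-firstBlockCut) ⟩
    k firstBlockSize * prodR R (map (blockProd R k) (gapMonomial P (firstBlockCut P)))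
      ∎
    where
    firstFactor : kernelBlockProd (map (at P) firstBlock) ≈ k firstBlockSize
    firstFactor = ≈-trans (reflexive (cong kernelBlockProd firstBlock-labels)) (kernelBlockProd-replicate 1≤firstBlockSize)
    restrictedGaps : ∀ gs → prodR R (map (blockProd R k) (map (restrict P) (filterᵇ nonEmpty gs))) ≈ gapProduct gs
    restrictedGaps []             = ≈-refl
    restrictedGaps ([] ∷ gs)      = ≈-trans (restrictedGaps gs) (≈-sym (*-identityˡ _))
    restrictedGaps ((x ∷ D) ∷ gs) = *-cong (blockProd-restrict P (x ∷ D)) (restrictedGaps gs)

-- The half-shuffle exponential

module PrecExponential {c ℓ} (R : CommutativeRing c ℓ) (k : ℕ → CommutativeRing.Carrier R) (κ φ : LinForm R)
  (κ-inf : IsInfChar R κ)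
  (κ-I : ∀ n → 1 ≤ n → CommutativeRing._≈_ R (κ (I n ∷ [])) (k n))
  (κ-other : ∀ P → IsNCP P → (∀ n → P ≢ I n) → CommutativeRing._≈_ R (κ (P ∷ [])) (CommutativeRing.0# R))
  (φ-exp : IsExpPrec R κ φ) where

  open CommutativeRing R renaming (refl to ≈-refl; sym to ≈-sym; trans to ≈-trans)
  open RingSums R
  open import Relation.Binary.Reasoning.Setoid setoid

  cutTerm : Word → List (List Bool) → Carrier
  cutTerm w cs = κ (cutLeft w cs) * φ (cutRight w cs)

  module _ (P : List ℕ) (P-ncp : IsNCP P) (w : Word) (w-ncp : All IsNCP w) where
    open FirstBlock P P-ncp

    firstCut : List (List Bool)
    firstCut = firstBlockCut P ∷ map emptyCut w

    κ-cutLeft-vanishes : ∀ S cs → S ∈ cutsOf P → cs ∈ wordCuts w → T (atB S 0) → S ∷ cs ≢ firstCut →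
      κ (cutLeft (P ∷ w) (S ∷ cs)) ≈ 0#
    κ-cutLeft-vanishes S cs S∈ cs∈ S∋0 S∷cs≢first = vanishes (lowerElems P S) refl
      where
      vanishes : ∀ X → lowerElems P S ≡ X → κ (cutLeft (P ∷ w) (S ∷ cs)) ≈ 0#
      vanishes []       X≡ = ⊥-elim (case subst (0 ∈_) X≡ (0∈lowerElems P S P-ncp S∋0) of λ ())
      vanishes (x ∷ xs) X≡ =
        ≈-trans (reflexive (cong (κ ∘ (_++ cutLeft w cs)) (lowerPart-∷ P S X≡))) (vanishesWith (cutLeft w cs) refl)
        where
        L = restrict P (x ∷ xs)
        L-ncp : IsNCP L
        L-ncp = All.head (subst (All IsNCP) (lowerPart-∷ P S X≡) (lowerPart-isNCP P S P-ncp))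
        -- Either the left factor is a product of two letters, or it is the single letter L,
        -- which has at least two blocks.
        vanishesWith : ∀ rest → cutLeft w cs ≡ rest → κ (L ∷ rest) ≈ 0#
        vanishesWith (r ∷ rs) rest≡ =
          proj₂ κ-inf L r rs (All⇒validWord (L ∷ r ∷ rs) (L-ncp ∷ subst (All IsNCP) rest≡ (cutLeft-isNCP w cs w-ncp)))
        vanishesWith []       rest≡ =
          κ-other L L-ncp λ m L≡I →
            restrict-lowerElems≢I P S P-ncp (∈-cutsOf⇒length P S∈) S∋0 S≢first m (trans (cong (restrict P) X≡) L≡I)
          where
          S≢first : S ≢ firstBlockCut P
          S≢first S≡ = S∷cs≢first (cong₂ _∷_ S≡ (cutLeft≡[]⇒emptyCuts w cs w-ncp cs∈ rest≡))

    firstCut-once : occurrences _≟ʷ_ firstCut (wordCuts (P ∷ w)) ≡ 1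
    firstCut-once = occurrences-wordCuts {P ∷ w} {firstCut} ((firstBlockCut-isLowerset , length-firstBlockCut) ∷ emptyCuts w)
      where
      emptyCuts : ∀ w → Pointwise IsCutOf w (map emptyCut w)
      emptyCuts []      = []
      emptyCuts (Q ∷ w) = emptyCut-isCut Q ∷ emptyCuts w

    precSum≈firstCutTerm : sumR R (map (cutTerm (P ∷ w)) (precCuts (P ∷ w))) ≈ cutTerm (P ∷ w) firstCut
    precSum≈firstCutTerm = viaFilter _ refl (λ _ _ → refl)
      where
      -- The predicate selecting the cuts of Δ_≺ is local to precCuts; unification names it here.
      viaFilter : ∀ first → precCuts (P ∷ w) ≡ filterᵇ first (wordCuts (P ∷ w)) →
        (∀ S cs → first (S ∷ cs) ≡ atB S 0) →
        sumR R (map (cutTerm (P ∷ w)) (precCuts (P ∷ w))) ≈ cutTerm (P ∷ w) firstCut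
      viaFilter first prec≡ first≡ =
        ≈-trans (reflexive (cong (sumR R ∘ map (cutTerm (P ∷ w))) prec≡))
          (sumR-supported-once _≟ʷ_ firstCut (cutTerm (P ∷ w)) (filterᵇ first (wordCuts (P ∷ w))) otherVanishes
            (trans (occurrences-filterᵇ _≟ʷ_ first firstCut (wordCuts (P ∷ w)) (subst T (sym (first≡ _ _)) tt)) firstCut-once))
        where
        otherVanishes : ∀ {cs} → cs ∈ filterᵇ first (wordCuts (P ∷ w)) → cs ≢ firstCut → cutTerm (P ∷ w) cs ≈ 0#
        otherVanishes cs∈ cs≢ with ∈-filter⁻ (T? ∘ first) {xs = wordCuts (P ∷ w)} cs∈
        ... | cs∈′ , first-cs with ∈-wordCuts⁻ P w cs∈′
        ...   | S , cs′ , refl , S∈ , cs′∈ =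
          ≈-trans (*-congʳ (κ-cutLeft-vanishes S cs′ S∈ cs′∈ (subst T (first≡ S cs′) first-cs) cs≢)) (zeroˡ _)

    φ-firstBlock : φ (P ∷ w) ≈ k firstBlockSize * φ (gapMonomial P (firstBlockCut P) ++ w)
    φ-firstBlock = begin
      φ (P ∷ w)                                                   ≈⟨ φ-exp (P ∷ w) (All⇒validWord (P ∷ w) (P-ncp ∷ w-ncp)) ⟩
      0# + sumR R (map (cutTerm (P ∷ w)) (precCuts (P ∷ w)))      ≈⟨ +-identityˡ _ ⟩
      sumR R (map (cutTerm (P ∷ w)) (precCuts (P ∷ w)))           ≈⟨ precSum≈firstCutTerm ⟩
      cutTerm (P ∷ w) firstCut                                    ≈⟨ *-cong κ-firstCut (reflexive (cong φ φ-arg)) ⟩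
      k firstBlockSize * φ (gapMonomial P (firstBlockCut P) ++ w) ∎
      where
      κ-firstCut : κ (cutLeft (P ∷ w) firstCut) ≈ k firstBlockSize
      κ-firstCut = ≈-trans (reflexive (cong κ (cong₂ _++_ lowerPart-firstBlockCut (cutLeft-emptyCuts w))))
                           (κ-I firstBlockSize 1≤firstBlockSize)
      φ-arg : cutRight (P ∷ w) firstCut ≡ gapMonomial P (firstBlockCut P) ++ w
      φ-arg = cong (gapMonomial P (firstBlockCut P) ++_) (cutRight-emptyCuts w w-ncp)

  φ-word : ∀ {s} w → wordSize w < s → All IsNCP w → φ w ≈ prodR R (map (blockProd R k) w)
  φ-word {suc s} []      _           []              = ≈-trans (φ-exp [] tt) (+-identityʳ 1#)
  φ-word {suc s} (P ∷ w) (s≤s size≤s) (P-ncp ∷ w-ncp) = begin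
    φ (P ∷ w)
      ≈⟨ φ-firstBlock P P-ncp w w-ncp ⟩
    k firstBlockSize * φ (gm ++ w)
      ≈⟨ *-congˡ (φ-word (gm ++ w) smaller (AllP.++⁺ gapMonomial-firstBlockCut-isNCP w-ncp)) ⟩
    k firstBlockSize * prodR R (map (blockProd R k) (gm ++ w))
      ≈⟨ *-congˡ (≈-trans (reflexive (cong (prodR R) (map-++ (blockProd R k) gm w)))
                          (prodR-++ (map (blockProd R k) gm) (map (blockProd R k) w))) ⟩
    k firstBlockSize * (prodR R (map (blockProd R k) gm) * prodR R (map (blockProd R k) w))
      ≈⟨ ≈-sym (*-assoc _ _ _) ⟩
    (k firstBlockSize * prodR R (map (blockProd R k) gm)) * prodR R (map (blockProd R k) w)
      ≈⟨ *-congʳ (≈-sym blockProd-decomposition) ⟩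
    blockProd R k P * prodR R (map (blockProd R k) w)
      ∎
    where
    open FirstBlock P P-ncp
    open FirstBlockProduct R k P P-ncp using (blockProd-decomposition)
    gm = gapMonomial P (firstBlockCut P)
    smaller : wordSize (gm ++ w) < s
    smaller = subst (_< s) (sym (wordSize-++ gm w)) (<-≤-trans (+-monoˡ-< (wordSize w) wordSize-gapMonomial<n) size≤s)

J-coarser : ∀ {c ℓ} (R : CommutativeRing c ℓ) n Q → T (coarser R Q (J n))
J-coarser R n Q = T-all⁺ _ ns λ {i} i∈ → T-all⁺ _ ns λ {j} j∈ →
  subst (λ x → T (not (x ≡ᵇ at (J n) j) ∨ (at Q i ≡ᵇ at Q j))) (sym (at-J i∈))
    (subst (λ y → T (not (i ≡ᵇ y) ∨ (at Q i ≡ᵇ at Q j))) (sym (at-J j∈)) (sameOrDistinct i j))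
  where
  ns = upTo (length (J n))
  at-J : ∀ {i} → i ∈ ns → at (J n) i ≡ i
  at-J i∈ = at-upTo n (subst (_ <_) (length-upTo n) (∈-upTo⁻ i∈))
  sameOrDistinct : ∀ i j → T (not (i ≡ᵇ j) ∨ (at Q i ≡ᵇ at Q j))
  sameOrDistinct i j with i ≡ᵇ j in i≡j
  ... | false = tt
  ... | true rewrite ≡ᵇ⇒≡ i j (≡true⇒T i≡j) = ≡⇒≡ᵇ (at Q j) (at Q j) refl

∈-NCPs⇒isNCP : ∀ {n Q} → Q ∈ NCPs n → IsNCP Q
∈-NCPs⇒isNCP {n} Q∈ = proj₂ (∈-filter⁻ (T? ∘ isNCP) {xs = allLists n n} Q∈)

module _ {c ℓ} (R : CommutativeRing c ℓ) where
  open CommutativeRing R renaming (refl to ≈-refl; trans to ≈-trans)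
  open RingSums R

  actRight-ζ-J : ∀ (α : LinForm R) n → actRight R α (ζ R) (J n) ≈ sumR R (map (λ Q → α (Q ∷ [])) (NCPs n))
  actRight-ζ-J α n = ≈-trans (reflexive allCoarser) (sumR-cong (NCPs n) (λ {Q} _ → ζ-factor Q))
    where
    term : List ℕ → Carrier
    term Q = α (Q ∷ []) * charQuot R (ζ R) (J n) Q
    allCoarser : actRight R α (ζ R) (J n) ≡ sumR R (map term (NCPs n))
    allCoarser = cong (sumR R ∘ map term)
      (trans (cong (λ m → filterᵇ (λ Q → coarser R Q (J n)) (NCPs m)) (length-upTo n))
             (filter-all (T? ∘ (λ Q → coarser R Q (J n))) (All.universal (J-coarser R n) (NCPs n))))
    ζ-factor : ∀ Q → term Q ≈ α (Q ∷ [])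
    ζ-factor Q = ≈-trans (*-congˡ (prodR-≈1 _ (upTo (nBlocks Q)) (λ _ → ≈-refl))) (*-identityʳ _)

mainTheorem15 : ∀ {c ℓ} (R : CommutativeRing c ℓ) → IsFieldChar0 R →
    let open CommutativeRing R in
    (k : ℕ → Carrier) (κ φ : LinForm R) →
    IsInfChar R κ →
    (∀ n → 1 ≤ n → κ (I n ∷ []) ≈ k n) →
    (∀ P → IsNCP P → (∀ n → P ≢ I n) → κ (P ∷ []) ≈ 0#) →
    IsExpPrec R κ φ →
    (∀ P → IsNCP P → φ (P ∷ []) ≈ blockProd R k P)
    × (∀ n → 1 ≤ n → actRight R φ (ζ R) (J n) ≈ sumR R (map (blockProd R k) (NCPs n)))
mainTheorem15 R _ k κ φ κ-inf κ-I κ-other φ-exp = φ-letter , φ↶ζ-J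
  where
  open CommutativeRing R renaming (trans to ≈-trans)
  open RingSums R
  open PrecExponential R k κ φ κ-inf κ-I κ-other φ-exp

  φ-letter : ∀ P → IsNCP P → φ (P ∷ []) ≈ blockProd R k P
  φ-letter P P-ncp = ≈-trans (φ-word (P ∷ []) (n<1+n _) (P-ncp ∷ [])) (*-identityʳ _)

  φ↶ζ-J : ∀ n → 1 ≤ n → actRight R φ (ζ R) (J n) ≈ sumR R (map (blockProd R k) (NCPs n))
  φ↶ζ-J n _ = ≈-trans (actRight-ζ-J R φ n) (sumR-cong (NCPs n) (λ {Q} Q∈ → φ-letter Q (∈-NCPs⇒isNCP {n} Q∈)))
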